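{- For every $k\ge1$, the torpid mixing gadget $H_k$ has $16k+4$ vertices and exactly $2$ perfect matchings. Furthermore, $|\mathcal{N}_{H_k}(u,v)|=1$ and $|\mathcal{N}_{H_k}(x_1,v)|\ge 2^k$.
   Context: Chain of boxes $B_k$ ($k\ge1$): take a path $v_0,v_1,\dots,v_{2k-1}$; for each $i=0,\dots,k-1$ add two new vertices $a_i,b_i$ and edges $\{v_{2i},a_i\},\{a_i,b_i\},\{b_i,v_{2i+1}\}$. It has $4k$ vertices; its endpoints are $v_0$ and $v_{2k-1}$. Torpid mixing gadget $H_k$: take a 12-cycle $c_0c_1\cdots c_{11}c_0$, let $a=c_0$, $b=c_6$ and add the edge $\{a,b\}$. Let $u=c_3$, $v=c_9$, $w_1=c_2$, $w_2=c_4$, $z_1=c_{10}$, $z_2=c_8$, and $x_1=c_1$ (the cycle vertex between $w_1$ and $a$). Add four copies of $B_k$ (with otherwise new, disjoint vertices), identifying their endpoints $(v_0,v_{2k-1})$ with $(w_1,a)$, $(a,z_1)$, $(w_2,b)$, $(b,z_2)$ respectively. For a graph $H$ and distinct vertices $p,q$, $\mathcal{N}_H(p,q)$ denotes the set of matchings of $H$ whose unmatched vertices are exactly $p$ and $q$. -}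

module Defs where

open import Data.Nat using (ℕ; zero; suc; _+_; _*_; _∸_; _≤_; _≡ᵇ_)
open import Data.Fin using (Fin; #_)
open import Data.Bool using (Bool; true; false; if_then_else_; _∨_)
open import Data.List using (List; []; _∷_; _++_; map; applyUpTo; concatMap; length)
open import Data.List.Membership.Propositional using (_∈_)
open import Data.Vec using (Vec; []; _∷_)
open import Data.Product using (_×_; _,_; Σ; ∃)
open import Data.Sum using (_⊎_)
open import Relation.Binary.PropositionalEquality using (_≡_)
open import Relation.Nullary using (does)
open import Function.Definitions using (Injective)
open import Function.Bundles using (_⇔_)
import Data.Fin.Properties as FinP
import Data.Nat.Properties as NatP

-- Vertices of the torpid mixing gadget H_k.
--   c i      : cycle vertex c_i  (i < 12)
--   pv j t   : internal path vertex v_t of the j-th copy of B_k (1 ≤ t ≤ 2k-2)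
--   av j i   : vertex a_i of the j-th copy of B_k
--   bv j i   : vertex b_i of the j-th copy of B_k
-- (the endpoints v_0, v_{2k-1} of each copy are identified with cycle vertices)

data V : Set where
  c  : Fin 12 → V
  pv : Fin 4 → ℕ → V
  av : Fin 4 → ℕ → V
  bv : Fin 4 → ℕ → V

_==_ : V → V → Bool
c i == c i′ = does (i FinP.≟ i′)
pv j t == pv j′ t′ = does (j FinP.≟ j′) Data.Bool.∧ (t ≡ᵇ t′)
av j t == av j′ t′ = does (j FinP.≟ j′) Data.Bool.∧ (t ≡ᵇ t′)
bv j t == bv j′ t′ = does (j FinP.≟ j′) Data.Bool.∧ (t ≡ᵇ t′)
_ == _ = false

Edge : Set
Edge = V × V

boxPath : ℕ → Fin 4 → V → V → ℕ → V
boxPath k j e0 e1 t =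
  if t ≡ᵇ 0 then e0 else if t ≡ᵇ (2 * k ∸ 1) then e1 else pv j t

boxVerts : ℕ → Fin 4 → List V
boxVerts k j =
  applyUpTo (λ t → pv j (suc t)) (2 * k ∸ 2)
  ++ applyUpTo (av j) k
  ++ applyUpTo (bv j) k

boxEdges : ℕ → Fin 4 → V → V → List Edge
boxEdges k j e0 e1 =
  applyUpTo (λ t → (boxPath k j e0 e1 t , boxPath k j e0 e1 (suc t))) (2 * k ∸ 1)
  ++ concatMap (λ i → (boxPath k j e0 e1 (2 * i) , av j i)
                      ∷ (av j i , bv j i)
                      ∷ (bv j i , boxPath k j e0 e1 (suc (2 * i)))
                      ∷ [])
               (applyUpTo (λ i → i) k)

cycleVerts : List V
cycleVerts = c (# 0) ∷ c (# 1) ∷ c (# 2) ∷ c (# 3) ∷ c (# 4) ∷ c (# 5)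
           ∷ c (# 6) ∷ c (# 7) ∷ c (# 8) ∷ c (# 9) ∷ c (# 10) ∷ c (# 11) ∷ []

cycleEdges : List Edge
cycleEdges =
    (c (# 0) , c (# 1)) ∷ (c (# 1) , c (# 2)) ∷ (c (# 2) , c (# 3))
  ∷ (c (# 3) , c (# 4)) ∷ (c (# 4) , c (# 5)) ∷ (c (# 5) , c (# 6))
  ∷ (c (# 6) , c (# 7)) ∷ (c (# 7) , c (# 8)) ∷ (c (# 8) , c (# 9))
  ∷ (c (# 9) , c (# 10)) ∷ (c (# 10) , c (# 11)) ∷ (c (# 11) , c (# 0))
  ∷ (c (# 0) , c (# 6)) ∷ []

a b u v w₁ w₂ z₁ z₂ x₁ : V
a  = c (# 0)
b  = c (# 6)
u  = c (# 3)
v  = c (# 9)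
w₁ = c (# 2)
w₂ = c (# 4)
z₁ = c (# 10)
z₂ = c (# 8)
x₁ = c (# 1)

Hverts : ℕ → List V
Hverts k = cycleVerts ++ boxVerts k (# 0) ++ boxVerts k (# 1)
                      ++ boxVerts k (# 2) ++ boxVerts k (# 3)

Hedges : ℕ → List Edge
Hedges k = cycleEdges ++ boxEdges k (# 0) w₁ a ++ boxEdges k (# 1) a z₁
                      ++ boxEdges k (# 2) w₂ b ++ boxEdges k (# 3) b z₂

-- Matchings: a set of edges of an (duplicate-free) edge list es is
-- encoded by its indicator vector Vec Bool (length es).

EdgeSet : List Edge → Set
EdgeSet es = Vec Bool (length es)

incident : Edge → V → Bool
incident (p , q) x = (p == x) ∨ (q == x)

degree : (es : List Edge) → EdgeSet es → V → ℕ
degree [] [] x = 0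
degree (e ∷ es) (true ∷ s) x = (if incident e x then 1 else 0) + degree es s x
degree (e ∷ es) (false ∷ s) x = degree es s x

IsMatching : (es : List Edge) → EdgeSet es → Set
IsMatching es M = ∀ x → degree es M x ≤ 1

IsPerfectMatching : List V → (es : List Edge) → EdgeSet es → Set
IsPerfectMatching vs es M = IsMatching es M × (∀ x → x ∈ vs → degree es M x ≡ 1)

InN : List V → (es : List Edge) → V → V → EdgeSet es → Set
InN vs es p q M =
  IsMatching es M × (∀ x → x ∈ vs → (degree es M x ≡ 0 ⇔ (x ≡ p ⊎ x ≡ q)))

HasCard : {es : List Edge} → (EdgeSet es → Set) → ℕ → Set
HasCard {es} S n =
  Σ (Fin n → EdgeSet es) λ f →
    Injective _≡_ _≡_ f × (∀ i → S (f i)) × (∀ M → S M → ∃ λ i → f i ≡ M)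

HasCardAtLeast : {es : List Edge} → (EdgeSet es → Set) → ℕ → Set
HasCardAtLeast {es} S n =
  Σ (Fin n → EdgeSet es) λ f → Injective _≡_ _≡_ f × (∀ i → S (f i))

module Submission where

open import Defs
open import Data.Nat using (ℕ; zero; suc; _+_; _*_; _^_; _∸_; _<_; _≤_; z≤n; s≤s; _≡ᵇ_; ⌊_/2⌋; _<?_)
open import Data.Nat.Properties
open import Data.Nat.Tactic.RingSolver using (solve-∀)
open import Data.Bool using (Bool; true; false; if_then_else_; _∨_; _∧_; not; T)
open import Data.Fin using (Fin; #_; toℕ) renaming (zero to fzero; suc to fsuc)
import Data.Fin.Properties as FinP
open import Data.List using (List; []; _∷_; _++_; length; applyUpTo; concatMap)
open import Data.List.Properties using (length-++; length-applyUpTo)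
open import Data.List.Membership.Propositional using (_∈_)
open import Data.List.Membership.Propositional.Properties
  using (∈-applyUpTo⁺; ∈-applyUpTo⁻; ∈-++⁺ˡ; ∈-++⁺ʳ; ∈-++⁻; ∈-tabulate⁺; ∈-tabulate⁻)
open import Data.List.Relation.Unary.Unique.Propositional using (Unique)
open import Data.List.Relation.Unary.Unique.Propositional.Properties using (++⁺; applyUpTo⁺₁; tabulate⁺)
open import Data.List.Relation.Binary.Disjoint.Propositional using (Disjoint)
open import Data.Vec using ([]; _∷_)
open import Data.Product using (Σ; ∃; _×_; _,_; proj₁; proj₂)
open import Data.Sum using (_⊎_; inj₁; inj₂)
open import Data.Empty using (⊥-elim)
open import Data.Unit using (tt)
open import Function using (_∘_; id; flip)
open import Function.Bundles using (_⇔_; mk⇔; Equivalence)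
open import Function.Definitions using (Injective)
open import Relation.Binary.PropositionalEquality
open import Relation.Nullary using (¬_; does; yes; no)
open import Relation.Nullary.Decidable using (dec-true; dec-false; from-yes)

-- A chain of boxes whose inner vertices are all matched inside the chain
-- matches both of its endpoints or neither: walking along the chain, the
-- number of chain edges leaving v_{2i} forwards (v_{2i}v_{2i+1} or v_{2i}a_i)
-- is the same for every i. If neither endpoint is matched, the chain uses
-- exactly the rungs a_i b_i and the path edges v_{2i+1}v_{2i+2}; if both are,
-- each box independently takes v_{2i}v_{2i+1} and a_i b_i or the detour
-- v_{2i}a_i, b_i v_{2i+1}, which gives 2^k choices.
--
-- So on the cycle, a matching of H_k covering every box vertex looks like a
-- matching of the 12-cycle with chord {a,b} and four extra edges, one per
-- box, joining its endpoints. There the odd cycle vertices lie on cycle edges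
-- only, and a short case analysis shows that the perfect matchings are the
-- two alternating ones, that the only matching missing exactly u and v uses
-- the chord, and that a matching missing exactly x₁ and v uses the box edge
-- w₁a; the latter lifts to 2^k matchings of H_k.

bit : Bool → ℕ
bit false = 0
bit true  = 1

bit≡0 : ∀ {b} → bit b ≡ 0 → b ≡ false
bit≡0 {false} _ = refl

bit≡1 : ∀ {b} → bit b ≡ 1 → b ≡ true
bit≡1 {true} _ = refl

≤1⇒bit : ∀ {n} → n ≤ 1 → Σ Bool λ b → n ≡ bit b
≤1⇒bit {zero}        _        = false , refl
≤1⇒bit {suc zero}    _        = true , refl
≤1⇒bit {suc (suc n)} (s≤s ())

≤1∧≢0⇒≡1 : ∀ {n} → n ≤ 1 → n ≢ 0 → n ≡ 1
≤1∧≢0⇒≡1 {zero}        _        n≢0 = ⊥-elim (n≢0 refl)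
≤1∧≢0⇒≡1 {suc zero}    _        _   = refl
≤1∧≢0⇒≡1 {suc (suc n)} (s≤s ()) _

weight : Bool → Edge → V → ℕ
weight s e x = if incident e x then bit s else 0

-- Unlike degree, deg does not inspect the chosen bits, so it computes on
-- edge sets whose bits are variables.
deg : (es : List Edge) → EdgeSet es → V → ℕ
deg []       []      x = 0
deg (e ∷ es) (s ∷ M) x = weight s e x + deg es M x

degree≡deg : ∀ es M x → degree es M x ≡ deg es M x
degree≡deg []       []          x = refl
degree≡deg (e ∷ es) (true  ∷ M) x with incident e x
... | true  = cong suc (degree≡deg es M x)
... | false = degree≡deg es M x
degree≡deg (e ∷ es) (false ∷ M) x with incident e x
... | true  = degree≡deg es M x
... | false = degree≡deg es M x

split : ∀ xs ys → EdgeSet (xs ++ ys) → EdgeSet xs × EdgeSet ys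
split []       ys M       = [] , M
split (x ∷ xs) ys (s ∷ M) with split xs ys M
... | P , Q = s ∷ P , Q

join : ∀ xs ys → EdgeSet xs → EdgeSet ys → EdgeSet (xs ++ ys)
join []       ys []      Q = Q
join (x ∷ xs) ys (s ∷ P) Q = s ∷ join xs ys P Q

join-split : ∀ xs ys M → let (P , Q) = split xs ys M in join xs ys P Q ≡ M
join-split []       ys M       = refl
join-split (x ∷ xs) ys (s ∷ M) = cong (s ∷_) (join-split xs ys M)

split-join : ∀ xs ys P Q → split xs ys (join xs ys P Q) ≡ (P , Q)
split-join []       ys []      Q = refl
split-join (x ∷ xs) ys (s ∷ P) Q rewrite split-join xs ys P Q = refl

deg-join : ∀ xs ys P Q x → deg (xs ++ ys) (join xs ys P Q) x ≡ deg xs P x + deg ys Q x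
deg-join []       ys []      Q x = refl
deg-join (e ∷ xs) ys (s ∷ P) Q x =
  trans (cong (weight s e x +_) (deg-join xs ys P Q x)) (sym (+-assoc (weight s e x) _ _))

Σ< : ℕ → (ℕ → ℕ) → ℕ
Σ< zero    f = 0
Σ< (suc n) f = f 0 + Σ< n (f ∘ suc)

Σ<-zero : ∀ n f → (∀ t → t < n → f t ≡ 0) → Σ< n f ≡ 0
Σ<-zero zero    f f≡0 = refl
Σ<-zero (suc n) f f≡0 =
  cong₂ _+_ (f≡0 0 (s≤s z≤n)) (Σ<-zero n _ (λ t t<n → f≡0 (suc t) (s≤s t<n)))

Σ<-single : ∀ n f i → i < n → (∀ t → t < n → t ≢ i → f t ≡ 0) → Σ< n f ≡ f i
Σ<-single (suc n) f zero    _         f≡0 =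
  trans (cong (f 0 +_) (Σ<-zero n _ (λ t t<n → f≡0 (suc t) (s≤s t<n) (λ ())))) (+-identityʳ _)
Σ<-single (suc n) f (suc i) (s≤s i<n) f≡0 =
  trans (cong (_+ Σ< n (f ∘ suc)) (f≡0 0 (s≤s z≤n) (λ ())))
        (Σ<-single n _ i i<n (λ t t<n t≢i → f≡0 (suc t) (s≤s t<n) (t≢i ∘ suc-injective)))

Σ<-pair : ∀ n f i → suc i < n → (∀ t → t < n → t ≢ i → t ≢ suc i → f t ≡ 0) →
          Σ< n f ≡ f i + f (suc i)
Σ<-pair (suc n) f zero    (s≤s i<n) f≡0 =
  cong (f 0 +_) (Σ<-single n _ 0 i<n (λ t t<n t≢0 → f≡0 (suc t) (s≤s t<n) (λ ()) (t≢0 ∘ suc-injective)))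
Σ<-pair (suc n) f (suc i) (s≤s i<n) f≡0 =
  trans (cong (_+ Σ< n (f ∘ suc)) (f≡0 0 (s≤s z≤n) (λ ()) (λ ())))
        (Σ<-pair n _ i i<n (λ t t<n t≢i t≢i+1 →
           f≡0 (suc t) (s≤s t<n) (t≢i ∘ suc-injective) (t≢i+1 ∘ suc-injective)))

_◂_ : Bool → (ℕ → Bool) → ℕ → Bool
(s ◂ g) zero    = s
(s ◂ g) (suc t) = g t

select : ∀ n (f : ℕ → Edge) → (ℕ → Bool) → EdgeSet (applyUpTo f n)
select zero    f g = []
select (suc n) f g = g 0 ∷ select n (f ∘ suc) (g ∘ suc)

pick : ∀ n (f : ℕ → Edge) → EdgeSet (applyUpTo f n) → ℕ → Bool
pick zero    f []      = λ _ → false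
pick (suc n) f (s ∷ M) = s ◂ pick n (f ∘ suc) M

select-pick : ∀ n f M → select n f (pick n f M) ≡ M
select-pick zero    f []      = refl
select-pick (suc n) f (s ∷ M) = cong (s ∷_) (select-pick n (f ∘ suc) M)

select-cong : ∀ n f g h → (∀ t → t < n → g t ≡ h t) → select n f g ≡ select n f h
select-cong zero    f g h g≗h = refl
select-cong (suc n) f g h g≗h =
  cong₂ _∷_ (g≗h 0 (s≤s z≤n)) (select-cong n (f ∘ suc) _ _ (λ t t<n → g≗h (suc t) (s≤s t<n)))

pick-select : ∀ n f g t → t < n → pick n f (select n f g) t ≡ g t
pick-select (suc n) f g zero    _         = refl
pick-select (suc n) f g (suc t) (s≤s t<n) = pick-select n (f ∘ suc) (g ∘ suc) t t<n

deg-select : ∀ n f g x → deg (applyUpTo f n) (select n f g) x ≡ Σ< n (λ t → weight (g t) (f t) x)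
deg-select zero    f g x = refl
deg-select (suc n) f g x = cong (weight (g 0) (f 0) x +_) (deg-select n (f ∘ suc) (g ∘ suc) x)

module Triples (E₁ E₂ E₃ : ℕ → Edge) where

  triples : (ℕ → ℕ) → ℕ → List Edge
  triples h n = concatMap (λ i → E₁ i ∷ E₂ i ∷ E₃ i ∷ []) (applyUpTo h n)

  select₃ : ∀ h n → (α β γ : ℕ → Bool) → EdgeSet (triples h n)
  select₃ h zero    α β γ = []
  select₃ h (suc n) α β γ = α 0 ∷ β 0 ∷ γ 0 ∷ select₃ (h ∘ suc) n (α ∘ suc) (β ∘ suc) (γ ∘ suc)

  pick₃ : ∀ h n → EdgeSet (triples h n) → (ℕ → Bool) × (ℕ → Bool) × (ℕ → Bool)
  pick₃ h zero    []                 = (λ _ → false) , (λ _ → false) , (λ _ → false)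
  pick₃ h (suc n) (s₁ ∷ s₂ ∷ s₃ ∷ M) with pick₃ (h ∘ suc) n M
  ... | α , β , γ = s₁ ◂ α , s₂ ◂ β , s₃ ◂ γ

  select₃-pick₃ : ∀ h n M → let (α , β , γ) = pick₃ h n M in select₃ h n α β γ ≡ M
  select₃-pick₃ h zero    []                 = refl
  select₃-pick₃ h (suc n) (s₁ ∷ s₂ ∷ s₃ ∷ M) = cong (λ N → s₁ ∷ s₂ ∷ s₃ ∷ N) (select₃-pick₃ (h ∘ suc) n M)

  select₃-cong : ∀ h n {α β γ α′ β′ γ′} →
    (∀ t → t < n → α t ≡ α′ t) → (∀ t → t < n → β t ≡ β′ t) → (∀ t → t < n → γ t ≡ γ′ t) →
    select₃ h n α β γ ≡ select₃ h n α′ β′ γ′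
  select₃-cong h zero    eα eβ eγ = refl
  select₃-cong h (suc n) eα eβ eγ
    rewrite eα 0 (s≤s z≤n) | eβ 0 (s≤s z≤n) | eγ 0 (s≤s z≤n) =
    cong (λ N → _ ∷ _ ∷ _ ∷ N)
      (select₃-cong (h ∘ suc) n (λ t t<n → eα (suc t) (s≤s t<n))
                                (λ t t<n → eβ (suc t) (s≤s t<n)) (λ t t<n → eγ (suc t) (s≤s t<n)))

  weight₃ : ∀ (h : ℕ → ℕ) (α β γ : ℕ → Bool) → V → ℕ → ℕ
  weight₃ h α β γ x i =
    weight (α i) (E₁ (h i)) x + (weight (β i) (E₂ (h i)) x + weight (γ i) (E₃ (h i)) x)

  deg-select₃ : ∀ h n α β γ x → deg (triples h n) (select₃ h n α β γ) x ≡ Σ< n (weight₃ h α β γ x)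
  deg-select₃ h zero    α β γ x = refl
  deg-select₃ h (suc n) α β γ x =
    trans (+-assoc₃ (weight (α 0) (E₁ (h 0)) x) (weight (β 0) (E₂ (h 0)) x) (weight (γ 0) (E₃ (h 0)) x) _)
          (cong (weight₃ h α β γ x 0 +_) (deg-select₃ (h ∘ suc) n (α ∘ suc) (β ∘ suc) (γ ∘ suc) x))
    where
    +-assoc₃ : ∀ p q r s → p + (q + (r + s)) ≡ (p + (q + r)) + s
    +-assoc₃ p q r s = trans (cong (p +_) (sym (+-assoc q r s))) (sym (+-assoc p (q + r) s))

==-refl : ∀ x → T (x == x)
==-refl (c i)    with i FinP.≟ i
... | yes _  = tt
... | no i≢i = i≢i refl
==-refl (pv j t) with j FinP.≟ j
... | yes _  = ≡⇒≡ᵇ t t refl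
... | no j≢j = j≢j refl
==-refl (av j t) with j FinP.≟ j
... | yes _  = ≡⇒≡ᵇ t t refl
... | no j≢j = j≢j refl
==-refl (bv j t) with j FinP.≟ j
... | yes _  = ≡⇒≡ᵇ t t refl
... | no j≢j = j≢j refl

==⇒≡ : ∀ x y → T (x == y) → x ≡ y
==⇒≡ (c i)    (c i′)     eq with i FinP.≟ i′
... | yes refl = refl
==⇒≡ (pv j t) (pv j′ t′) eq with j FinP.≟ j′
... | yes refl = cong (pv j) (≡ᵇ⇒≡ t t′ eq)
==⇒≡ (av j t) (av j′ t′) eq with j FinP.≟ j′
... | yes refl = cong (av j) (≡ᵇ⇒≡ t t′ eq)
==⇒≡ (bv j t) (bv j′ t′) eq with j FinP.≟ j′
... | yes refl = cong (bv j) (≡ᵇ⇒≡ t t′ eq)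

≢⇒==-false : ∀ x y → x ≢ y → (x == y) ≡ false
≢⇒==-false x y x≢y with x == y in eq
... | true  = ⊥-elim (x≢y (==⇒≡ x y (subst T (sym eq) tt)))
... | false = refl

weight-≢ : ∀ s p q x → p ≢ x → q ≢ x → weight s (p , q) x ≡ 0
weight-≢ s p q x p≢x q≢x rewrite ≢⇒==-false p x p≢x | ≢⇒==-false q x q≢x = refl

weight-≡ˡ : ∀ s p q x → p ≡ x → weight s (p , q) x ≡ bit s
weight-≡ˡ s p q x refl with p == p | ==-refl p
... | true | _ = refl

weight-≡ʳ : ∀ s p q x → q ≡ x → weight s (p , q) x ≡ bit s
weight-≡ʳ s p q x refl with p == q | q == q | ==-refl q
... | true  | _    | _ = refl
... | false | true | _ = refl

c-injective : ∀ {i i′} → c i ≡ c i′ → i ≡ i′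
c-injective refl = refl

av-injective : ∀ {j i i′} → av j i ≡ av j i′ → i ≡ i′
av-injective refl = refl

bv-injective : ∀ {j i i′} → bv j i ≡ bv j i′ → i ≡ i′
bv-injective refl = refl

data Owned (j : Fin 4) : V → Set where
  pv-own : ∀ s → Owned j (pv j s)
  av-own : ∀ i → Owned j (av j i)
  bv-own : ∀ i → Owned j (bv j i)

¬Owned-c : ∀ {j i} → ¬ Owned j (c i)
¬Owned-c ()

Owned-unique : ∀ {j j′ x} → Owned j x → Owned j′ x → j ≡ j′
Owned-unique (pv-own s) (pv-own s) = refl
Owned-unique (av-own i) (av-own i) = refl
Owned-unique (bv-own i) (bv-own i) = refl

data BoxVertex (k : ℕ) (j : Fin 4) : V → Set where
  inner : ∀ t → t < 2 * k ∸ 2 → BoxVertex k j (pv j (suc t))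
  a-    : ∀ i → i < k → BoxVertex k j (av j i)
  b-    : ∀ i → i < k → BoxVertex k j (bv j i)

boxVertex : ∀ k j {x} → x ∈ boxVerts k j → BoxVertex k j x
boxVertex k j x∈ with ∈-++⁻ (applyUpTo (λ t → pv j (suc t)) (2 * k ∸ 2)) x∈
... | inj₁ x∈p with ∈-applyUpTo⁻ (λ t → pv j (suc t)) x∈p
...   | t , t< , refl = inner t t<
boxVertex k j x∈ | inj₂ x∈ab with ∈-++⁻ (applyUpTo (av j) k) x∈ab
... | inj₁ x∈a with ∈-applyUpTo⁻ (av j) x∈a
...   | i , i<k , refl = a- i i<k
boxVertex k j x∈ | inj₂ x∈ab | inj₂ x∈b with ∈-applyUpTo⁻ (bv j) x∈b
...   | i , i<k , refl = b- i i<k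

boxVertex-owned : ∀ {k j x} → BoxVertex k j x → Owned j x
boxVertex-owned (inner t _) = pv-own (suc t)
boxVertex-owned (a- i _)    = av-own i
boxVertex-owned (b- i _)    = bv-own i

boxVerts-owned : ∀ k j {x} → x ∈ boxVerts k j → Owned j x
boxVerts-owned k j = boxVertex-owned ∘ boxVertex k j

parity : ∀ t → Σ ℕ λ i → t ≡ 2 * i ⊎ t ≡ suc (2 * i)
parity zero = 0 , inj₁ refl
parity (suc t) with parity t
... | i , inj₁ refl = i , inj₂ refl
... | i , inj₂ refl = suc i , inj₁ (sym (*-suc 2 i))

alternate : Bool → (ℕ → Bool) → ℕ → Bool
alternate e g zero          = e ∧ g 0
alternate e g (suc zero)    = not e
alternate e g (suc (suc t)) = alternate e (g ∘ suc) t

alternate-even : ∀ e g i → alternate e g (2 * i) ≡ e ∧ g i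
alternate-even e g zero    = refl
alternate-even e g (suc i) = trans (cong (alternate e g) (*-suc 2 i)) (alternate-even e (g ∘ suc) i)

alternate-odd : ∀ e g i → alternate e g (suc (2 * i)) ≡ not e
alternate-odd e g zero    = refl
alternate-odd e g (suc i) = trans (cong (alternate e g ∘ suc) (*-suc 2 i)) (alternate-odd e (g ∘ suc) i)

record Choice : Set where
  constructor choice
  field usesPath usesEntry usesRung usesExit : ℕ → Bool
open Choice public

-- standard true g: box i uses v_{2i} v_{2i+1} and a_i b_i if g i, and the
-- detour v_{2i} a_i, b_i v_{2i+1} otherwise; standard false g ignores g and
-- uses the rungs and the path edges v_{2i+1} v_{2i+2}.
standard : Bool → (ℕ → Bool) → Choice
standard e g = choice (alternate e g) (λ i → e ∧ not (g i)) (λ i → not e ∨ g i) (λ i → e ∧ not (g i))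

idle : Choice
idle = standard false (λ _ → false)

atEnds : Fin 12 × Fin 12 → ℕ → Fin 12 → ℕ
atEnds (i₀ , i₁) n i = if does (i FinP.≟ i₀) ∨ does (i FinP.≟ i₁) then n else 0

module Box (k′ : ℕ) (j : Fin 4) (i₀ i₁ : Fin 12) (i₀≢i₁ : i₀ ≢ i₁) where

  open ≡-Reasoning

  k : ℕ
  k = suc k′

  last : ℕ
  last = 2 * k ∸ 1

  last≡ : last ≡ suc (2 * k′)
  last≡ = cong (_∸ 1) (*-suc 2 k′)

  2k∸2≡ : 2 * k ∸ 2 ≡ 2 * k′
  2k∸2≡ = cong (_∸ 2) (*-suc 2 k′)

  path : ℕ → V
  path = boxPath k j (c i₀) (c i₁)

  pathEdge entry rung exit : ℕ → Edge
  pathEdge t = path t , path (suc t)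
  entry i = path (2 * i) , av j i
  rung  i = av j i , bv j i
  exit  i = bv j i , path (suc (2 * i))

  open Triples entry rung exit

  pathEdges detourEdges : List Edge
  pathEdges   = applyUpTo pathEdge last
  detourEdges = triples id k

  edges : List Edge
  edges = boxEdges k j (c i₀) (c i₁)

  path-shape : ∀ t → (t ≡ 0 × path t ≡ c i₀) ⊎ (t ≡ last × path t ≡ c i₁) ⊎ (t ≢ last × path t ≡ pv j t)
  path-shape zero = inj₁ (refl , refl)
  path-shape (suc t) with suc t ≡ᵇ last in eq
  ... | true  = inj₂ (inj₁ (≡ᵇ⇒≡ _ _ (subst T (sym eq) tt) , refl))
  ... | false = inj₂ (inj₂ ((λ t≡last → subst T eq (≡⇒≡ᵇ _ _ t≡last)) , refl))

  position : V → ℕ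
  position (c i)    = if does (i FinP.≟ i₀) then 0 else last
  position (pv _ t) = t
  position _        = 0

  position-path : ∀ t → position (path t) ≡ t
  position-path t with path-shape t
  ... | inj₁ (refl , p)        rewrite p | dec-true (i₀ FinP.≟ i₀) refl = refl
  ... | inj₂ (inj₁ (refl , p)) rewrite p | dec-false (i₁ FinP.≟ i₀) (i₀≢i₁ ∘ sym) = refl
  ... | inj₂ (inj₂ (_ , p))    rewrite p = refl

  path-injective : ∀ {t s} → path t ≡ path s → t ≡ s
  path-injective {t} {s} eq = trans (sym (position-path t)) (trans (cong position eq) (position-path s))

  path-≢ : ∀ {t s} → t ≢ s → path t ≢ path s
  path-≢ t≢s = t≢s ∘ path-injective

  path-last : path last ≡ c i₁
  path-last with path-shape last
  ... | inj₁ (last≡0 , _)           = ⊥-elim (0≢1+n (trans (sym last≡0) last≡))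
  ... | inj₂ (inj₁ (_ , p))         = p
  ... | inj₂ (inj₂ (last≢last , _)) = ⊥-elim (last≢last refl)

  path-inner : ∀ t → t < 2 * k′ → path (suc t) ≡ pv j (suc t)
  path-inner t t<2k′ with path-shape (suc t)
  ... | inj₂ (inj₁ (t+1≡last , _)) = ⊥-elim (<⇒≢ (subst (suc t <_) (sym last≡) (s≤s t<2k′)) t+1≡last)
  ... | inj₂ (inj₂ (_ , p))        = p

  path≢ : ∀ t {x} → x ≢ c i₀ → x ≢ c i₁ → x ≢ pv j t → path t ≢ x
  path≢ t x≢i₀ x≢i₁ x≢pv eq with path-shape t
  ... | inj₁ (_ , p)        = x≢i₀ (trans (sym eq) p)
  ... | inj₂ (inj₁ (_ , p)) = x≢i₁ (trans (sym eq) p)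
  ... | inj₂ (inj₂ (_ , p)) = x≢pv (trans (sym eq) p)

  path≢av : ∀ t {j′ i} → path t ≢ av j′ i
  path≢av t = path≢ t (λ ()) (λ ()) (λ ())

  path≢bv : ∀ t {j′ i} → path t ≢ bv j′ i
  path≢bv t = path≢ t (λ ()) (λ ()) (λ ())

  path≡pv : ∀ {t j′ s} → path t ≡ pv j′ s → j ≡ j′ × t ≡ s × t ≢ 0 × t ≢ last
  path≡pv {t} eq with path-shape t
  ... | inj₁ (_ , p)             = ⊥-elim (c≢pv (trans (sym p) eq))
    where c≢pv : ∀ {i j′ s} → c i ≢ pv j′ s
          c≢pv ()
  ... | inj₂ (inj₁ (_ , p))      = ⊥-elim (c≢pv (trans (sym p) eq))
    where c≢pv : ∀ {i j′ s} → c i ≢ pv j′ s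
          c≢pv ()
  ... | inj₂ (inj₂ (t≢last , p)) with trans (sym p) eq
  ...   | refl = refl , refl , (λ { refl → path0≢pv p }) , t≢last
    where path0≢pv : path 0 ≢ pv j 0
          path0≢pv ()

  edgeSet : Choice → EdgeSet edges
  edgeSet C = join pathEdges detourEdges (select last pathEdge (usesPath C))
                                         (select₃ id k (usesEntry C) (usesRung C) (usesExit C))

  choiceOf : EdgeSet edges → Choice
  choiceOf M with split pathEdges detourEdges M
  ... | P , Q with pick₃ id k Q
  ... | α , β , γ = choice (pick last pathEdge P) α β γ

  edgeSet-choiceOf : ∀ M → edgeSet (choiceOf M) ≡ M
  edgeSet-choiceOf M with split pathEdges detourEdges M | join-split pathEdges detourEdges M
  ... | P , Q | PQ≡M with pick₃ id k Q | select₃-pick₃ id k Q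
  ... | α , β , γ | αβγ≡Q =
    trans (cong₂ (join pathEdges detourEdges) (select-pick last pathEdge P) αβγ≡Q) PQ≡M

  usesPath-injective : ∀ {C C′} → edgeSet C ≡ edgeSet C′ → ∀ t → t < last → usesPath C t ≡ usesPath C′ t
  usesPath-injective {C} {C′} eq t t<last = begin
    usesPath C t                       ≡⟨ sym (pick-select last pathEdge (usesPath C) t t<last) ⟩
    pick last pathEdge (pathSet C) t   ≡⟨ cong (λ S → pick last pathEdge S t) pathSets≡ ⟩
    pick last pathEdge (pathSet C′) t  ≡⟨ pick-select last pathEdge (usesPath C′) t t<last ⟩
    usesPath C′ t                      ∎
    where
    pathSet : Choice → EdgeSet pathEdges
    pathSet C = select last pathEdge (usesPath C)
    pathSets≡ : pathSet C ≡ pathSet C′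
    pathSets≡ = cong proj₁ (trans (sym (split-join pathEdges detourEdges _ _))
                                  (trans (cong (split pathEdges detourEdges) eq) (split-join pathEdges detourEdges _ _)))

  boxDeg : Choice → V → ℕ
  boxDeg C x = Σ< last (λ t → weight (usesPath C t) (pathEdge t) x)
             + Σ< k (weight₃ id (usesEntry C) (usesRung C) (usesExit C) x)

  deg-edgeSet : ∀ C x → deg edges (edgeSet C) x ≡ boxDeg C x
  deg-edgeSet C x =
    trans (deg-join pathEdges detourEdges _ _ x)
          (cong₂ _+_ (deg-select last pathEdge (usesPath C) x)
                     (deg-select₃ id k (usesEntry C) (usesRung C) (usesExit C) x))

  deg≡boxDeg : ∀ M x → deg edges M x ≡ boxDeg (choiceOf M) x
  deg≡boxDeg M x = trans (cong (λ N → deg edges N x) (sym (edgeSet-choiceOf M))) (deg-edgeSet (choiceOf M) x)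

  Far : V → Set
  Far x = (∀ t → t ≤ last → path t ≢ x) × (∀ i → i < k → av j i ≢ x) × (∀ i → i < k → bv j i ≢ x)

  far-c : ∀ {i} → i ≢ i₀ → i ≢ i₁ → Far (c i)
  far-c i≢i₀ i≢i₁ = (λ t _ → path≢ t (i≢i₀ ∘ c-injective) (i≢i₁ ∘ c-injective) (λ ())) , (λ _ _ ()) , (λ _ _ ())

  owned-far : ∀ {j′ x} → j′ ≢ j → Owned j′ x → Far x
  owned-far j′≢j (pv-own s) = (λ t _ eq → j′≢j (sym (proj₁ (path≡pv {t} eq)))) , (λ _ _ ()) , (λ _ _ ())
  owned-far j′≢j (av-own i) = (λ t _ → path≢av t) , (λ { _ _ refl → j′≢j refl }) , (λ _ _ ())
  owned-far j′≢j (bv-own i) = (λ t _ → path≢bv t) , (λ _ _ ()) , (λ { _ _ refl → j′≢j refl })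

  -- Each formula below picks out the (at most three) box edges at the given
  -- vertex; every other summand vanishes because path is injective.
  module _ (C : Choice) where

    private
      P E R X : ℕ → Bool
      P = usesPath C
      E = usesEntry C
      R = usesRung C
      X = usesExit C

      pathTerm detourTerm : V → ℕ → ℕ
      pathTerm x t = weight (P t) (pathEdge t) x
      detourTerm x = weight₃ id E R X x

      detourTerm-≢ : ∀ x i → path (2 * i) ≢ x → av j i ≢ x → bv j i ≢ x → path (suc (2 * i)) ≢ x →
                     detourTerm x i ≡ 0
      detourTerm-≢ x i p≢x a≢x b≢x q≢x =
        cong₂ _+_ (weight-≢ (E i) (path (2 * i)) (av j i) x p≢x a≢x)
                  (cong₂ _+_ (weight-≢ (R i) (av j i) (bv j i) x a≢x b≢x)
                             (weight-≢ (X i) (bv j i) (path (suc (2 * i))) x b≢x q≢x))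

      2i+1≤last : ∀ {i} → i < k → suc (2 * i) ≤ last
      2i+1≤last (s≤s i≤k′) rewrite last≡ = s≤s (*-monoʳ-≤ 2 i≤k′)

    boxDeg-far : ∀ x → Far x → boxDeg C x ≡ 0
    boxDeg-far x (p≢x , a≢x , b≢x) =
      cong₂ _+_ (Σ<-zero last (pathTerm x) (λ t t<last →
                   weight-≢ (P t) (path t) (path (suc t)) x (p≢x t (<⇒≤ t<last)) (p≢x (suc t) t<last)))
                (Σ<-zero k (detourTerm x) (λ i i<k →
                   detourTerm-≢ x i (p≢x (2 * i) (<⇒≤ (2i+1≤last i<k))) (a≢x i i<k) (b≢x i i<k)
                                    (p≢x _ (2i+1≤last i<k))))

    boxDeg-av : ∀ i → i < k → boxDeg C (av j i) ≡ bit (E i) + bit (R i)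
    boxDeg-av i i<k =
      trans (cong₂ _+_ (Σ<-zero last (pathTerm x) (λ t _ →
                          weight-≢ (P t) (path t) (path (suc t)) x (path≢av t) (path≢av (suc t))))
                       (Σ<-single k (detourTerm x) i i<k (λ t _ t≢i →
                          detourTerm-≢ x t (path≢av (2 * t)) (t≢i ∘ av-injective) (λ ()) (path≢av (suc (2 * t))))))
            (cong₂ _+_ (weight-≡ʳ (E i) (path (2 * i)) x x refl)
                       (trans (cong₂ _+_ (weight-≡ˡ (R i) x (bv j i) x refl)
                                         (weight-≢ (X i) (bv j i) (path (suc (2 * i))) x (λ ()) (path≢av (suc (2 * i)))))
                              (+-identityʳ _)))
      where x = av j i

    boxDeg-bv : ∀ i → i < k → boxDeg C (bv j i) ≡ bit (R i) + bit (X i)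
    boxDeg-bv i i<k =
      trans (cong₂ _+_ (Σ<-zero last (pathTerm x) (λ t _ →
                          weight-≢ (P t) (path t) (path (suc t)) x (path≢bv t) (path≢bv (suc t))))
                       (Σ<-single k (detourTerm x) i i<k (λ t _ t≢i →
                          detourTerm-≢ x t (path≢bv (2 * t)) (λ ()) (t≢i ∘ bv-injective) (path≢bv (suc (2 * t))))))
            (cong₂ _+_ (weight-≢ (E i) (path (2 * i)) (av j i) x (path≢bv (2 * i)) (λ ()))
                       (cong₂ _+_ (weight-≡ʳ (R i) (av j i) x x refl) (weight-≡ˡ (X i) x (path (suc (2 * i))) x refl)))
      where x = bv j i

    boxDeg-odd : ∀ i → suc i < k →
      boxDeg C (path (suc (2 * i))) ≡ (bit (P (2 * i)) + bit (P (suc (2 * i)))) + bit (X i)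
    boxDeg-odd i (s≤s i<k′) =
      cong₂ _+_
        (trans (Σ<-pair last (pathTerm x) (2 * i) s<last (λ t _ t≢2i t≢s →
                  weight-≢ (P t) (path t) (path (suc t)) x (path-≢ t≢s) (path-≢ (t≢2i ∘ suc-injective))))
               (cong₂ _+_ (weight-≡ʳ (P (2 * i)) (path (2 * i)) x x refl) (weight-≡ˡ (P s) x (path (suc s)) x refl)))
        (trans (Σ<-single k (detourTerm x) i (m<n⇒m<1+n i<k′) (λ t _ t≢i →
                  detourTerm-≢ x t (path-≢ (even≢odd t i)) (path≢av s ∘ sym) (path≢bv s ∘ sym)
                                   (path-≢ (t≢i ∘ *-cancelˡ-≡ t i 2 ∘ suc-injective))))
               (cong₂ _+_ (weight-≢ (E i) (path (2 * i)) (av j i) x (path-≢ (even≢odd i i)) (path≢av s ∘ sym))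
                          (cong₂ _+_ (weight-≢ (R i) (av j i) (bv j i) x (path≢av s ∘ sym) (path≢bv s ∘ sym))
                                     (weight-≡ʳ (X i) (bv j i) x x refl))))
      where
      s = suc (2 * i)
      x = path s
      s<last : s < last
      s<last rewrite last≡ = s≤s (*-monoʳ-< 2 i<k′)

    boxDeg-even : ∀ i → suc i < k →
      boxDeg C (path (suc (suc (2 * i)))) ≡ (bit (P (suc (2 * i))) + bit (P (suc (suc (2 * i))))) + bit (E (suc i))
    boxDeg-even i (s≤s i<k′) =
      cong₂ _+_
        (trans (Σ<-pair last (pathTerm x) s s+1<last (λ t _ t≢s t≢s+1 →
                  weight-≢ (P t) (path t) (path (suc t)) x (path-≢ t≢s+1) (path-≢ (t≢s ∘ suc-injective))))
               (cong₂ _+_ (weight-≡ʳ (P s) (path s) x x refl) (weight-≡ˡ (P (suc s)) x (path (suc (suc s))) x refl)))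
        (trans (Σ<-single k (detourTerm x) (suc i) (s≤s i<k′) (λ t _ t≢i+1 →
                  detourTerm-≢ x t (path-≢ (t≢i+1 ∘ *-cancelˡ-≡ t (suc i) 2 ∘ flip trans (sym 2[i+1])))
                                   (path≢av (suc s) ∘ sym) (path≢bv (suc s) ∘ sym)
                                   (path-≢ (even≢odd (suc i) t ∘ trans 2[i+1] ∘ sym))))
               (trans (cong₂ _+_ (weight-≡ˡ (E (suc i)) (path (2 * suc i)) (av j (suc i)) x (cong path 2[i+1]))
                                 (cong₂ _+_ (weight-≢ (R (suc i)) (av j (suc i)) (bv j (suc i)) x
                                                      (path≢av (suc s) ∘ sym) (path≢bv (suc s) ∘ sym))
                                            (weight-≢ (X (suc i)) (bv j (suc i)) (path (suc (2 * suc i))) x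
                                                      (path≢bv (suc s) ∘ sym)
                                                      (path-≢ (even≢odd (suc i) (suc i) ∘ trans 2[i+1] ∘ sym)))))
                      (+-identityʳ _)))
      where
      s = suc (2 * i)
      x = path (suc s)
      2[i+1] : 2 * suc i ≡ suc s
      2[i+1] = *-suc 2 i
      s+1<last : suc s < last
      s+1<last rewrite last≡ = s≤s (subst (_≤ 2 * k′) 2[i+1] (*-monoʳ-≤ 2 i<k′))

    boxDeg-start : boxDeg C (c i₀) ≡ bit (P 0) + bit (E 0)
    boxDeg-start =
      cong₂ _+_
        (trans (Σ<-single last (pathTerm x) 0 0<last (λ t _ t≢0 →
                  weight-≢ (P t) (path t) (path (suc t)) x (path-≢ t≢0) (path-≢ 1+n≢0)))
               (weight-≡ˡ (P 0) x (path 1) x refl))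
        (trans (Σ<-single k (detourTerm x) 0 (s≤s z≤n) (λ t _ t≢0 →
                  detourTerm-≢ x t (path-≢ (t≢0 ∘ *-cancelˡ-≡ t 0 2)) (λ ()) (λ ()) (path-≢ 1+n≢0)))
               (trans (cong₂ _+_ (weight-≡ˡ (E 0) x (av j 0) x refl)
                                 (cong₂ _+_ (weight-≢ (R 0) (av j 0) (bv j 0) x (λ ()) (λ ()))
                                            (weight-≢ (X 0) (bv j 0) (path 1) x (λ ()) (path-≢ 1+n≢0))))
                      (+-identityʳ _)))
      where
      x = path 0
      0<last : 0 < last
      0<last rewrite last≡ = s≤s z≤n

    boxDeg-end : boxDeg C (c i₁) ≡ bit (P (2 * k′)) + bit (X k′)
    boxDeg-end = subst (λ y → boxDeg C y ≡ bit (P (2 * k′)) + bit (X k′)) path-last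
      (cong₂ _+_
        (trans (Σ<-single last (pathTerm x) (2 * k′) 2k′<last (λ t t<last t≢2k′ →
                  weight-≢ (P t) (path t) (path (suc t)) x (path-≢ (<⇒≢ t<last))
                           (path-≢ (t≢2k′ ∘ suc-injective ∘ flip trans last≡))))
               (weight-≡ʳ (P (2 * k′)) (path (2 * k′)) (path (suc (2 * k′))) x (cong path (sym last≡))))
        (trans (Σ<-single k (detourTerm x) k′ ≤-refl (λ t _ t≢k′ →
                  detourTerm-≢ x t (path-≢ (even≢odd t k′ ∘ flip trans last≡)) (path≢av last ∘ sym) (path≢bv last ∘ sym)
                                   (path-≢ (t≢k′ ∘ *-cancelˡ-≡ t k′ 2 ∘ suc-injective ∘ flip trans last≡))))
               (cong₂ _+_ (weight-≢ (E k′) (path (2 * k′)) (av j k′) x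
                                    (path-≢ (even≢odd k′ k′ ∘ flip trans last≡)) (path≢av last ∘ sym))
                          (cong₂ _+_ (weight-≢ (R k′) (av j k′) (bv j k′) x (path≢av last ∘ sym) (path≢bv last ∘ sym))
                                     (weight-≡ʳ (X k′) (bv j k′) (path (suc (2 * k′))) x (cong path (sym last≡)))))))
      where
      x = path last
      2k′<last : 2 * k′ < last
      2k′<last rewrite last≡ = ≤-refl

  pv∈ : ∀ t → t < 2 * k′ → pv j (suc t) ∈ boxVerts k j
  pv∈ t t<2k′ = ∈-++⁺ˡ (∈-applyUpTo⁺ (λ t → pv j (suc t)) (subst (t <_) (sym 2k∸2≡) t<2k′))

  av∈ : ∀ i → i < k → av j i ∈ boxVerts k j
  av∈ i i<k = ∈-++⁺ʳ (applyUpTo (λ t → pv j (suc t)) (2 * k ∸ 2)) (∈-++⁺ˡ (∈-applyUpTo⁺ (av j) i<k))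

  bv∈ : ∀ i → i < k → bv j i ∈ boxVerts k j
  bv∈ i i<k = ∈-++⁺ʳ (applyUpTo (λ t → pv j (suc t)) (2 * k ∸ 2))
                      (∈-++⁺ʳ (applyUpTo (av j) k) (∈-applyUpTo⁺ (bv j) i<k))

  Interior : Choice → Set
  Interior C = ∀ x → x ∈ boxVerts k j → boxDeg C x ≡ 1

  module _ {C : Choice} (interior : Interior C) where

    private
      P E R X : ℕ → Bool
      P = usesPath C
      E = usesEntry C
      R = usesRung C
      X = usesExit C

      inner-deg : ∀ t → t < 2 * k′ → boxDeg C (path (suc t)) ≡ 1
      inner-deg t t<2k′ = subst (λ y → boxDeg C y ≡ 1) (sym (path-inner t t<2k′)) (interior _ (pv∈ t t<2k′))

      i<k′⇒2i+1<2k′ : ∀ {i} → i < k′ → suc (2 * i) < 2 * k′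
      i<k′⇒2i+1<2k′ {i} i<k′ = subst (_≤ 2 * k′) (*-suc 2 i) (*-monoʳ-≤ 2 i<k′)

    entry≡exit : ∀ i → i < k → E i ≡ X i
    entry≡exit i i<k = shared (E i) (R i) (X i)
      (trans (sym (boxDeg-av C i i<k)) (interior _ (av∈ i i<k)))
      (trans (sym (boxDeg-bv C i i<k)) (interior _ (bv∈ i i<k)))
      where
      shared : ∀ p q r → bit p + bit q ≡ 1 → bit q + bit r ≡ 1 → p ≡ r
      shared true  false true  _ _ = refl
      shared false true  false _ _ = refl

    odd-vertex : ∀ i → suc i < k → (bit (P (2 * i)) + bit (P (suc (2 * i)))) + bit (X i) ≡ 1
    odd-vertex i (s≤s i<k′) =
      trans (sym (boxDeg-odd C i (s≤s i<k′))) (inner-deg (2 * i) (<-trans (n<1+n _) (i<k′⇒2i+1<2k′ i<k′)))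

    even-vertex : ∀ i → suc i < k → (bit (P (suc (2 * i))) + bit (P (suc (suc (2 * i))))) + bit (E (suc i)) ≡ 1
    even-vertex i (s≤s i<k′) =
      trans (sym (boxDeg-even C i (s≤s i<k′))) (inner-deg (suc (2 * i)) (i<k′⇒2i+1<2k′ i<k′))

    forward : ℕ → ℕ
    forward i = bit (P (2 * i)) + bit (E i)

    forward-step : ∀ i → suc i < k → forward i ≡ forward (suc i)
    forward-step i i+1<k = begin
      forward i        ≡⟨ cong (λ b → p + bit b) (entry≡exit i (<-trans (n<1+n i) i+1<k)) ⟩
      p + x            ≡⟨ +-cancelˡ-≡ q _ _ (begin
                            q + (p + x)  ≡⟨ trans (sym (+-assoc q p x)) (cong (_+ x) (+-comm q p)) ⟩
                            (p + q) + x  ≡⟨ odd-vertex i i+1<k ⟩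
                            1            ≡⟨ sym (even-vertex i i+1<k) ⟩
                            (q + r) + e  ≡⟨ +-assoc q r e ⟩
                            q + (r + e)  ∎) ⟩
      r + e            ≡⟨ cong (λ t → bit (P t) + e) (sym (*-suc 2 i)) ⟩
      forward (suc i)  ∎
      where
      p = bit (P (2 * i))
      q = bit (P (suc (2 * i)))
      r = bit (P (suc (suc (2 * i))))
      x = bit (X i)
      e = bit (E (suc i))

    forward-const : ∀ i → i < k → forward 0 ≡ forward i
    forward-const zero    _     = refl
    forward-const (suc i) i+1<k = trans (forward-const i (<-trans (n<1+n i) i+1<k)) (forward-step i i+1<k)

    balanced : boxDeg C (c i₀) ≡ boxDeg C (c i₁)
    balanced = begin
      boxDeg C (c i₀)                ≡⟨ boxDeg-start C ⟩
      forward 0                      ≡⟨ forward-const k′ ≤-refl ⟩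
      forward k′                     ≡⟨ cong (λ b → bit (P (2 * k′)) + bit b) (entry≡exit k′ ≤-refl) ⟩
      bit (P (2 * k′)) + bit (X k′)  ≡⟨ sym (boxDeg-end C) ⟩
      boxDeg C (c i₁)                ∎

    idle-unique : boxDeg C (c i₀) ≡ 0 → edgeSet C ≡ edgeSet idle
    idle-unique start≡0 =
      cong₂ (join pathEdges detourEdges) (select-cong last pathEdge _ _ path-idle)
                                         (select₃-cong id k entry-idle rung-idle exit-idle)
      where
      forward≡0 : ∀ i → i < k → forward i ≡ 0
      forward≡0 i i<k = trans (sym (forward-const i i<k)) (trans (sym (boxDeg-start C)) start≡0)

      even-idle : ∀ i → i < k → P (2 * i) ≡ false
      even-idle i i<k = bit≡0 (m+n≡0⇒m≡0 _ (forward≡0 i i<k))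

      entry-idle : ∀ i → i < k → E i ≡ false
      entry-idle i i<k = bit≡0 (m+n≡0⇒n≡0 (bit (P (2 * i))) (forward≡0 i i<k))

      exit-idle : ∀ i → i < k → X i ≡ false
      exit-idle i i<k = trans (sym (entry≡exit i i<k)) (entry-idle i i<k)

      rung-idle : ∀ i → i < k → R i ≡ true
      rung-idle i i<k = bit≡1 (subst (λ b → bit b + bit (R i) ≡ 1) (entry-idle i i<k)
                                (trans (sym (boxDeg-av C i i<k)) (interior _ (av∈ i i<k))))

      odd-idle : ∀ i → suc i < k → P (suc (2 * i)) ≡ true
      odd-idle i i+1<k = bit≡1 (trans (sym (+-identityʳ _))
                                 (subst₂ (λ p x → (bit p + bit (P (suc (2 * i)))) + bit x ≡ 1)
                                         (even-idle i i<k) (exit-idle i i<k) (odd-vertex i i+1<k)))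
        where i<k = <-trans (n<1+n i) i+1<k

      path-idle : ∀ t → t < last → P t ≡ usesPath idle t
      path-idle t t<last with parity t
      ... | i , inj₁ refl = trans (even-idle i (s≤s (*-cancelˡ-≤ 2 (≤-pred (subst (2 * i <_) last≡ t<last)))))
                                  (sym (alternate-even false _ i))
      ... | i , inj₂ refl = trans (odd-idle i (s≤s (*-cancelˡ-< 2 i k′ (≤-pred (subst (suc (2 * i) <_) last≡ t<last)))))
                                  (sym (alternate-odd false _ i))

    owned-≤1 : ∀ {x} → Owned j x → boxDeg C x ≤ 1
    owned-≤1 (pv-own zero)    = subst (_≤ 1) (sym (boxDeg-far C _ far)) z≤n
      where
      far : Far (pv j 0)
      far = (λ t _ eq → let (_ , t≡0 , t≢0 , _) = path≡pv {t} eq in t≢0 t≡0) , (λ _ _ ()) , (λ _ _ ())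
    owned-≤1 (pv-own (suc t)) with t <? 2 * k′
    ... | yes t<2k′ = ≤-reflexive (interior _ (pv∈ t t<2k′))
    ... | no  t≮2k′ = subst (_≤ 1) (sym (boxDeg-far C _ far)) z≤n
      where
      far : Far (pv j (suc t))
      far = (λ { t′ t′≤last eq → let (_ , t′≡t+1 , _ , t′≢last) = path≡pv {t′} eq in
                   t≮2k′ (≤-pred (subst₂ _<_ t′≡t+1 last≡ (≤∧≢⇒< t′≤last t′≢last))) })
          , (λ _ _ ()) , (λ _ _ ())
    owned-≤1 (av-own i) with i <? k
    ... | yes i<k = ≤-reflexive (interior _ (av∈ i i<k))
    ... | no  i≮k = subst (_≤ 1) (sym (boxDeg-far C _ far)) z≤n
      where
      far : Far (av j i)
      far = (λ t _ → path≢av t) , (λ { i′ i′<k refl → i≮k i′<k }) , (λ _ _ ())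
    owned-≤1 (bv-own i) with i <? k
    ... | yes i<k = ≤-reflexive (interior _ (bv∈ i i<k))
    ... | no  i≮k = subst (_≤ 1) (sym (boxDeg-far C _ far)) z≤n
      where
      far : Far (bv j i)
      far = (λ t _ → path≢bv t) , (λ _ _ ()) , (λ { i′ i′<k refl → i≮k i′<k })

    atEnds-boxDeg : ∀ i → boxDeg C (c i) ≡ atEnds (i₀ , i₁) (boxDeg C (c i₀)) i
    atEnds-boxDeg i with i FinP.≟ i₀
    ... | yes refl = refl
    ... | no i≢i₀ with i FinP.≟ i₁
    ...   | yes refl = sym balanced
    ...   | no i≢i₁  = boxDeg-far C _ (far-c i≢i₀ i≢i₁)

  module _ (e : Bool) (g : ℕ → Bool) where

    private
      odd-deg : ∀ e b → (bit (e ∧ b) + bit (not e)) + bit (e ∧ not b) ≡ 1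
      odd-deg true  true  = refl
      odd-deg true  false = refl
      odd-deg false _     = refl

      even-deg : ∀ e b → (bit (not e) + bit (e ∧ b)) + bit (e ∧ not b) ≡ 1
      even-deg true  true  = refl
      even-deg true  false = refl
      even-deg false _     = refl

      a-deg : ∀ e b → bit (e ∧ not b) + bit (not e ∨ b) ≡ 1
      a-deg true  true  = refl
      a-deg true  false = refl
      a-deg false _     = refl

      b-deg : ∀ e b → bit (not e ∨ b) + bit (e ∧ not b) ≡ 1
      b-deg true  true  = refl
      b-deg true  false = refl
      b-deg false _     = refl

      start-deg : ∀ e b → bit (e ∧ b) + bit (e ∧ not b) ≡ bit e
      start-deg true  true  = refl
      start-deg true  false = refl
      start-deg false _     = refl

    standard-inner : ∀ t → t < 2 * k′ → boxDeg (standard e g) (path (suc t)) ≡ 1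
    standard-inner t t<2k′ with parity t
    ... | i , inj₁ refl = begin
      boxDeg (standard e g) (path (suc (2 * i)))
        ≡⟨ boxDeg-odd (standard e g) i (s≤s (*-cancelˡ-< 2 i k′ t<2k′)) ⟩
      (bit (alternate e g (2 * i)) + bit (alternate e g (suc (2 * i)))) + bit (e ∧ not (g i))
        ≡⟨ cong₂ (λ p q → (bit p + bit q) + bit (e ∧ not (g i))) (alternate-even e g i) (alternate-odd e g i) ⟩
      (bit (e ∧ g i) + bit (not e)) + bit (e ∧ not (g i))
        ≡⟨ odd-deg e (g i) ⟩
      1 ∎
    ... | i , inj₂ refl = begin
      boxDeg (standard e g) (path (suc (suc (2 * i))))
        ≡⟨ boxDeg-even (standard e g) i (s≤s (*-cancelˡ-≤ 2 (subst (_≤ 2 * k′) (sym (*-suc 2 i)) t<2k′))) ⟩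
      (bit (alternate e g (suc (2 * i))) + bit (alternate e (g ∘ suc) (2 * i))) + bit (e ∧ not (g (suc i)))
        ≡⟨ cong₂ (λ p q → (bit p + bit q) + bit (e ∧ not (g (suc i))))
                 (alternate-odd e g i) (alternate-even e (g ∘ suc) i) ⟩
      (bit (not e) + bit (e ∧ g (suc i))) + bit (e ∧ not (g (suc i)))
        ≡⟨ even-deg e (g (suc i)) ⟩
      1 ∎

    standard-interior : Interior (standard e g)
    standard-interior x x∈ with boxVertex k j x∈
    ... | inner t t< = subst (λ y → boxDeg (standard e g) y ≡ 1) (path-inner t t<2k′) (standard-inner t t<2k′)
      where t<2k′ = subst (t <_) 2k∸2≡ t<
    ... | a- i i<k   = trans (boxDeg-av (standard e g) i i<k) (a-deg e (g i))
    ... | b- i i<k   = trans (boxDeg-bv (standard e g) i i<k) (b-deg e (g i))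

    standard-start : boxDeg (standard e g) (c i₀) ≡ bit e
    standard-start = trans (boxDeg-start (standard e g)) (start-deg e (g 0))

  crossing-injective : ∀ {g g′} → edgeSet (standard true g) ≡ edgeSet (standard true g′) → ∀ i → i < k → g i ≡ g′ i
  crossing-injective {g} {g′} eq i (s≤s i≤k′) =
    trans (sym (alternate-even true g i))
          (trans (usesPath-injective {standard true g} {standard true g′} eq (2 * i) 2i<last) (alternate-even true g′ i))
    where
    2i<last : 2 * i < last
    2i<last rewrite last≡ = s≤s (*-monoʳ-≤ 2 i≤k′)

Σ₄ : (Fin 4 → ℕ) → ℕ
Σ₄ f = f (# 0) + (f (# 1) + (f (# 2) + f (# 3)))

Σ₄-cong : ∀ {f g} → (∀ j → f j ≡ g j) → Σ₄ f ≡ Σ₄ g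
Σ₄-cong f≗g = cong₂ _+_ (f≗g _) (cong₂ _+_ (f≗g _) (cong₂ _+_ (f≗g _) (f≗g _)))

Σ₄-single : ∀ f j → (∀ j′ → j′ ≢ j → f j′ ≡ 0) → Σ₄ f ≡ f j
Σ₄-single f fzero f≡0 =
  trans (cong (f fzero +_) (cong₂ _+_ (f≡0 _ λ ()) (cong₂ _+_ (f≡0 _ λ ()) (f≡0 _ λ ())))) (+-identityʳ _)
Σ₄-single f (fsuc fzero) f≡0 =
  trans (cong₂ _+_ (f≡0 _ λ ()) (cong (f (# 1) +_) (cong₂ _+_ (f≡0 _ λ ()) (f≡0 _ λ ())))) (+-identityʳ _)
Σ₄-single f (fsuc (fsuc fzero)) f≡0 =
  trans (cong₂ _+_ (f≡0 _ λ ()) (cong₂ _+_ (f≡0 _ λ ()) (cong (f (# 2) +_) (f≡0 _ λ ())))) (+-identityʳ _)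
Σ₄-single f (fsuc (fsuc (fsuc fzero))) f≡0 =
  cong₂ _+_ (f≡0 _ λ ()) (cong₂ _+_ (f≡0 _ λ ()) (cong₂ _+_ (f≡0 _ λ ()) refl))

summand≤Σ₄ : ∀ f j → f j ≤ Σ₄ f
summand≤Σ₄ f fzero                      = m≤m+n (f (# 0)) _
summand≤Σ₄ f (fsuc fzero)               = ≤-trans (m≤m+n (f (# 1)) _) (m≤n+m _ (f (# 0)))
summand≤Σ₄ f (fsuc (fsuc fzero))        =
  ≤-trans (m≤m+n (f (# 2)) _) (≤-trans (m≤n+m _ (f (# 1))) (m≤n+m _ (f (# 0))))
summand≤Σ₄ f (fsuc (fsuc (fsuc fzero))) =
  ≤-trans (m≤n+m (f (# 3)) (f (# 2))) (≤-trans (m≤n+m _ (f (# 1))) (m≤n+m _ (f (# 0))))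

ends : Fin 4 → Fin 12 × Fin 12
ends fzero                      = # 2 , # 0
ends (fsuc fzero)               = # 0 , # 10
ends (fsuc (fsuc fzero))        = # 4 , # 6
ends (fsuc (fsuc (fsuc fzero))) = # 6 , # 8

-- The degree of c_i once every box j is contracted to an edge between its
-- endpoints, present iff d j.
skeletonDeg : EdgeSet cycleEdges → (Fin 4 → Bool) → Fin 12 → ℕ
skeletonDeg C d i = deg cycleEdges C (c i) + Σ₄ (λ j → atEnds (ends j) (bit (d j)) i)

missingDeg : Fin 12 → Fin 12 → Fin 12 → ℕ
missingDeg p q i = if does (i FinP.≟ p) ∨ does (i FinP.≟ q) then 0 else 1

missingDeg-cases : ∀ p q i → (missingDeg p q i ≡ 0 × (c i ≡ c p ⊎ c i ≡ c q))
                        ⊎ (missingDeg p q i ≡ 1 × ¬ (c i ≡ c p ⊎ c i ≡ c q))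
missingDeg-cases p q i with i FinP.≟ p
... | yes refl = inj₁ (refl , inj₁ refl)
... | no i≢p with i FinP.≟ q
...   | yes refl = inj₁ (refl , inj₂ refl)
...   | no i≢q   = inj₂ (refl , λ { (inj₁ refl) → i≢p refl ; (inj₂ refl) → i≢q refl })

boxBits : Bool → Bool → Bool → Bool → Fin 4 → Bool
boxBits d₀ d₁ d₂ d₃ fzero                      = d₀
boxBits d₀ d₁ d₂ d₃ (fsuc fzero)               = d₁
boxBits d₀ d₁ d₂ d₃ (fsuc (fsuc fzero))        = d₂
boxBits d₀ d₁ d₂ d₃ (fsuc (fsuc (fsuc fzero))) = d₃

NoBoxUsed : Bool → Bool → Bool → Bool → Set
NoBoxUsed d₀ d₁ d₂ d₃ = d₀ ≡ false × d₁ ≡ false × d₂ ≡ false × d₃ ≡ false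

NoBoxUsed⇒ : ∀ {d : Fin 4 → Bool} → NoBoxUsed (d (# 0)) (d (# 1)) (d (# 2)) (d (# 3)) → ∀ j → d j ≡ false
NoBoxUsed⇒ (n₀ , _ , _ , _) fzero                      = n₀
NoBoxUsed⇒ (_ , n₁ , _ , _) (fsuc fzero)               = n₁
NoBoxUsed⇒ (_ , _ , n₂ , _) (fsuc (fsuc fzero))        = n₂
NoBoxUsed⇒ (_ , _ , _ , n₃) (fsuc (fsuc (fsuc fzero))) = n₃

noBoxes firstBox : Fin 4 → Bool
noBoxes  = boxBits false false false false
firstBox = boxBits true  false false false

alternating₁ alternating₂ skeletonUV skeletonX : EdgeSet cycleEdges
alternating₁ = true  ∷ false ∷ true  ∷ false ∷ true  ∷ false ∷ true  ∷ false ∷ true  ∷ false ∷ true  ∷ false ∷ false ∷ []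
alternating₂ = false ∷ true  ∷ false ∷ true  ∷ false ∷ true  ∷ false ∷ true  ∷ false ∷ true  ∷ false ∷ true  ∷ false ∷ []
skeletonUV   = false ∷ true  ∷ false ∷ false ∷ true  ∷ false ∷ false ∷ true  ∷ false ∷ false ∷ true  ∷ false ∷ true  ∷ []
skeletonX    = false ∷ false ∷ false ∷ true  ∷ false ∷ true  ∷ false ∷ true  ∷ false ∷ false ∷ true  ∷ false ∷ false ∷ []

matched-odd : ∀ p q → (bit p + (bit q + 0)) + 0 ≡ 1 → q ≡ not p
matched-odd false true  _ = refl
matched-odd true  false _ = refl

unmatched-odd : ∀ p q → (bit p + (bit q + 0)) + 0 ≡ 0 → p ≡ false × q ≡ false
unmatched-odd false false _ = refl , refl

-- With b₂ᵢ₊₁ = not b₂ᵢ, the vertex c₂ᵢ₊₂ is matched twice unless b₂ᵢ₊₂ ≤ b₂ᵢ;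
-- going round the cycle all b₂ᵢ agree, and then the cycle edges already
-- match every even vertex, so neither the chord nor a box can be used.
perfect-even : ∀ b₀ b₂ b₄ b₆ b₈ b₁₀ b₁₂ d₀ d₁ d₂ d₃ →
  let C = b₀ ∷ not b₀ ∷ b₂ ∷ not b₂ ∷ b₄ ∷ not b₄ ∷ b₆ ∷ not b₆ ∷ b₈ ∷ not b₈ ∷ b₁₀ ∷ not b₁₀ ∷ b₁₂ ∷ []
      d = boxBits d₀ d₁ d₂ d₃
  in skeletonDeg C d (# 0) ≡ 1 → skeletonDeg C d (# 2) ≡ 1 → skeletonDeg C d (# 4) ≡ 1 →
     skeletonDeg C d (# 6) ≡ 1 → skeletonDeg C d (# 8) ≡ 1 → skeletonDeg C d (# 10) ≡ 1 →
     NoBoxUsed d₀ d₁ d₂ d₃ × (C ≡ alternating₁ ⊎ C ≡ alternating₂)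
perfect-even false true  _     _     _     _     _     _     _     _     _     _  () _  _  _  _
perfect-even false false true  _     _     _     _     _     _     _     _     _  _  () _  _  _
perfect-even false false false true  _     _     _     _     _     _     _     _  _  _  () _  _
perfect-even false false false false _     _     true  _     _     _     _     _  _  _  () _  _
perfect-even false false false false true  _     false _     _     _     _     _  _  _  _  () _
perfect-even false false false false false true  false _     _     _     _     _  _  _  _  _  ()
perfect-even false false false false false false false true  _     _     _     () _  _  _  _  _
perfect-even false false false false false false false false true  _     _     () _  _  _  _  _
perfect-even false false false false false false false false false true  _     _  _  _  () _  _
perfect-even false false false false false false false false false false true  _  _  _  () _  _
perfect-even false false false false false false false false false false false _  _  _  _  _  _ =
  (refl , refl , refl , refl) , inj₂ refl
perfect-even true  _     _     _     _     false _     _     _     _     _     () _  _  _  _  _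
perfect-even true  _     _     _     _     true  true  _     _     _     _     () _  _  _  _  _
perfect-even true  _     _     _     _     true  false true  _     _     _     () _  _  _  _  _
perfect-even true  _     _     _     _     true  false false true  _     _     () _  _  _  _  _
perfect-even true  _     _     _     false true  false false false _     _     _  _  _  _  _  ()
perfect-even true  _     _     false true  true  false false false _     _     _  _  _  _  () _
perfect-even true  _     _     true  true  true  false false false _     true  _  _  _  _  () _
perfect-even true  _     false true  true  true  false false false _     false _  _  _  () _  _
perfect-even true  _     true  true  true  true  false false false true  false _  _  _  () _  _
perfect-even true  false true  true  true  true  false false false false false _  _  () _  _  _
perfect-even true  true  true  true  true  true  false false false false false _  _  _  _  _  _ =
  (refl , refl , refl , refl) , inj₁ refl

perfect-skeleton : ∀ C d₀ d₁ d₂ d₃ → (∀ i → skeletonDeg C (boxBits d₀ d₁ d₂ d₃) i ≡ 1) →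
                   NoBoxUsed d₀ d₁ d₂ d₃ × (C ≡ alternating₁ ⊎ C ≡ alternating₂)
perfect-skeleton (b₀ ∷ b₁ ∷ b₂ ∷ b₃ ∷ b₄ ∷ b₅ ∷ b₆ ∷ b₇ ∷ b₈ ∷ b₉ ∷ b₁₀ ∷ b₁₁ ∷ b₁₂ ∷ []) d₀ d₁ d₂ d₃ deg≡1
  with matched-odd b₀ b₁ (deg≡1 (# 1)) | matched-odd b₂ b₃ (deg≡1 (# 3)) | matched-odd b₄ b₅ (deg≡1 (# 5))
     | matched-odd b₆ b₇ (deg≡1 (# 7)) | matched-odd b₈ b₉ (deg≡1 (# 9)) | matched-odd b₁₀ b₁₁ (deg≡1 (# 11))
... | refl | refl | refl | refl | refl | refl =
  perfect-even b₀ b₂ b₄ b₆ b₈ b₁₀ b₁₂ d₀ d₁ d₂ d₃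
    (deg≡1 (# 0)) (deg≡1 (# 2)) (deg≡1 (# 4)) (deg≡1 (# 6)) (deg≡1 (# 8)) (deg≡1 (# 10))

-- With c₃ and c₉ unmatched, if c₂ were matched by its box then c₁ would have
-- to take c₀, which that box covers as well; so c₂, and likewise c₁₀, is
-- matched along the cycle, c₀ can only take the chord {a,b}, and the chord
-- forces the rest.
uv-even : ∀ b₀ b₄ b₆ b₁₀ b₁₂ d₀ d₁ d₂ d₃ →
  let C = b₀ ∷ not b₀ ∷ false ∷ false ∷ b₄ ∷ not b₄ ∷ b₆ ∷ not b₆ ∷ false ∷ false ∷ b₁₀ ∷ not b₁₀ ∷ b₁₂ ∷ []
      d = boxBits d₀ d₁ d₂ d₃
  in skeletonDeg C d (# 0) ≡ 1 → skeletonDeg C d (# 2) ≡ 1 → skeletonDeg C d (# 4) ≡ 1 →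
     skeletonDeg C d (# 6) ≡ 1 → skeletonDeg C d (# 8) ≡ 1 → skeletonDeg C d (# 10) ≡ 1 →
     NoBoxUsed d₀ d₁ d₂ d₃ × C ≡ skeletonUV
uv-even true  _     _     _     _     false _     _     _     _  () _  _  _  _
uv-even true  _     _     false _     true  _     _     _     () _  _  _  _  _
uv-even true  _     _     true  true  true  _     _     _     () _  _  _  _  _
uv-even true  _     _     true  false true  _     _     _     () _  _  _  _  _
uv-even false _     _     _     _     true  _     _     _     _  () _  _  _  _
uv-even false _     _     false _     false false _     _     _  _  _  _  _  ()
uv-even false _     _     false true  false true  _     _     () _  _  _  _  _
uv-even false _     _     false false false true  _     _     () _  _  _  _  _
uv-even false _     _     true  _     false true  _     _     _  _  _  _  _  ()
uv-even false _     _     true  false false false _     _     () _  _  _  _  _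
uv-even false false true  true  true  false false _     _     _  _  _  () _  _
uv-even false false false true  true  false false _     _     _  _  _  () _  _
uv-even false true  true  true  true  false false _     _     _  _  _  () _  _
uv-even false true  false true  true  false false true  _     _  _  _  () _  _
uv-even false true  false true  true  false false false true  _  _  _  () _  _
uv-even false true  false true  true  false false false false _  _  _  _  _  _ =
  (refl , refl , refl , refl) , refl

uv-skeleton : ∀ C d₀ d₁ d₂ d₃ → (∀ i → skeletonDeg C (boxBits d₀ d₁ d₂ d₃) i ≡ missingDeg (# 3) (# 9) i) →
              NoBoxUsed d₀ d₁ d₂ d₃ × C ≡ skeletonUV
uv-skeleton (b₀ ∷ b₁ ∷ b₂ ∷ b₃ ∷ b₄ ∷ b₅ ∷ b₆ ∷ b₇ ∷ b₈ ∷ b₉ ∷ b₁₀ ∷ b₁₁ ∷ b₁₂ ∷ []) d₀ d₁ d₂ d₃ deg≡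
  with unmatched-odd b₂ b₃ (deg≡ (# 3)) | unmatched-odd b₈ b₉ (deg≡ (# 9))
     | matched-odd b₀ b₁ (deg≡ (# 1)) | matched-odd b₄ b₅ (deg≡ (# 5))
     | matched-odd b₆ b₇ (deg≡ (# 7)) | matched-odd b₁₀ b₁₁ (deg≡ (# 11))
... | refl , refl | refl , refl | refl | refl | refl | refl =
  uv-even b₀ b₄ b₆ b₁₀ b₁₂ d₀ d₁ d₂ d₃
    (deg≡ (# 0)) (deg≡ (# 2)) (deg≡ (# 4)) (deg≡ (# 6)) (deg≡ (# 8)) (deg≡ (# 10))

length-boxVerts : ∀ k j → length (boxVerts k j) ≡ (2 * k ∸ 2) + (k + k)
length-boxVerts k j =
  trans (length-++ (applyUpTo (λ t → pv j (suc t)) (2 * k ∸ 2)))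
        (cong₂ _+_ (length-applyUpTo _ (2 * k ∸ 2))
                   (trans (length-++ (applyUpTo (av j) k)) (cong₂ _+_ (length-applyUpTo _ k) (length-applyUpTo _ k))))

length-Hverts : ∀ k′ → length (Hverts (suc k′)) ≡ 16 * suc k′ + 4
length-Hverts k′ = begin
  length (Hverts k)
    ≡⟨ cong (12 +_) (trans (length-++ (boxVerts k (# 0))) (cong (ℓ (# 0) +_)
         (trans (length-++ (boxVerts k (# 1))) (cong (ℓ (# 1) +_) (length-++ (boxVerts k (# 2))))))) ⟩
  12 + (ℓ (# 0) + (ℓ (# 1) + (ℓ (# 2) + ℓ (# 3))))
    ≡⟨ cong (12 +_) (cong₂ _+_ (ℓ≡ _) (cong₂ _+_ (ℓ≡ _) (cong₂ _+_ (ℓ≡ _) (ℓ≡ _)))) ⟩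
  12 + (n + (n + (n + n)))
    ≡⟨ count k′ ⟩
  16 * suc k′ + 4 ∎
  where
  open ≡-Reasoning
  k = suc k′
  n = 2 * k′ + (k + k)
  ℓ : Fin 4 → ℕ
  ℓ j = length (boxVerts k j)
  ℓ≡ : ∀ j → ℓ j ≡ n
  ℓ≡ j = trans (length-boxVerts k j) (cong (λ m → m ∸ 2 + (k + k)) (*-suc 2 k′))
  count : ∀ m → let n = 2 * m + (suc m + suc m) in 12 + (n + (n + (n + n))) ≡ 16 * suc m + 4
  count = solve-∀

disjoint-applyUpTo : ∀ {f g : ℕ → V} {m n} → (∀ s t → f s ≢ g t) → Disjoint (applyUpTo f m) (applyUpTo g n)
disjoint-applyUpTo {f} {g} f≢g (x∈f , x∈g) with ∈-applyUpTo⁻ f x∈f | ∈-applyUpTo⁻ g x∈g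
... | s , _ , refl | t , _ , eq = f≢g s t eq

disjoint-++ : ∀ {xs} ys {zs : List V} → Disjoint xs ys → Disjoint xs zs → Disjoint xs (ys ++ zs)
disjoint-++ ys xs#ys xs#zs (x∈xs , x∈yzs) with ∈-++⁻ ys x∈yzs
... | inj₁ x∈ys = xs#ys (x∈xs , x∈ys)
... | inj₂ x∈zs = xs#zs (x∈xs , x∈zs)

unique-boxVerts : ∀ k j → Unique (boxVerts k j)
unique-boxVerts k j =
  ++⁺ (applyUpTo⁺₁ (λ t → pv j (suc t)) (2 * k ∸ 2) λ { s<t _ refl → <-irrefl refl s<t })
      (++⁺ (applyUpTo⁺₁ (av j) k λ { s<t _ refl → <-irrefl refl s<t })
           (applyUpTo⁺₁ (bv j) k λ { s<t _ refl → <-irrefl refl s<t })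
           (disjoint-applyUpTo {av j} {bv j} λ _ _ ()))
      (disjoint-++ (applyUpTo (av j) k) (disjoint-applyUpTo {λ t → pv j (suc t)} {av j} λ _ _ ())
                                        (disjoint-applyUpTo {λ t → pv j (suc t)} {bv j} λ _ _ ()))

disjoint-boxVerts : ∀ k {j j′} → j ≢ j′ → Disjoint (boxVerts k j) (boxVerts k j′)
disjoint-boxVerts k {j} {j′} j≢j′ (x∈ , x∈′) = j≢j′ (Owned-unique (boxVerts-owned k j x∈) (boxVerts-owned k j′ x∈′))

boxes-cases : ∀ k {x} → x ∈ boxVerts k (# 0) ++ boxVerts k (# 1) ++ boxVerts k (# 2) ++ boxVerts k (# 3) →
              Σ (Fin 4) λ j → x ∈ boxVerts k j
boxes-cases k x∈ with ∈-++⁻ (boxVerts k (# 0)) x∈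
... | inj₁ x∈₀ = # 0 , x∈₀
... | inj₂ x∈₁₂₃ with ∈-++⁻ (boxVerts k (# 1)) x∈₁₂₃
...   | inj₁ x∈₁ = # 1 , x∈₁
...   | inj₂ x∈₂₃ with ∈-++⁻ (boxVerts k (# 2)) x∈₂₃
...     | inj₁ x∈₂ = # 2 , x∈₂
...     | inj₂ x∈₃ = # 3 , x∈₃

Hverts-cases : ∀ k {x} → x ∈ Hverts k → (Σ (Fin 12) λ i → x ≡ c i) ⊎ (Σ (Fin 4) λ j → x ∈ boxVerts k j)
Hverts-cases k x∈ with ∈-++⁻ cycleVerts x∈
... | inj₁ x∈c = inj₁ (∈-tabulate⁻ {f = c} x∈c)
... | inj₂ x∈b = inj₂ (boxes-cases k x∈b)

c∈Hverts : ∀ k i → c i ∈ Hverts k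
c∈Hverts k i = ∈-++⁺ˡ (∈-tabulate⁺ {f = c} i)

boxVerts⊆Hverts : ∀ k j {x} → x ∈ boxVerts k j → x ∈ Hverts k
boxVerts⊆Hverts k fzero                      x∈ = ∈-++⁺ʳ cycleVerts (∈-++⁺ˡ x∈)
boxVerts⊆Hverts k (fsuc fzero)               x∈ = ∈-++⁺ʳ cycleVerts (∈-++⁺ʳ (boxVerts k (# 0)) (∈-++⁺ˡ x∈))
boxVerts⊆Hverts k (fsuc (fsuc fzero))        x∈ =
  ∈-++⁺ʳ cycleVerts (∈-++⁺ʳ (boxVerts k (# 0)) (∈-++⁺ʳ (boxVerts k (# 1)) (∈-++⁺ˡ x∈)))
boxVerts⊆Hverts k (fsuc (fsuc (fsuc fzero))) x∈ =
  ∈-++⁺ʳ cycleVerts (∈-++⁺ʳ (boxVerts k (# 0)) (∈-++⁺ʳ (boxVerts k (# 1)) (∈-++⁺ʳ (boxVerts k (# 2)) x∈)))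

unique-Hverts : ∀ k → Unique (Hverts k)
unique-Hverts k =
  ++⁺ (tabulate⁺ c-injective)
      (++⁺ (unique-boxVerts k (# 0))
           (++⁺ (unique-boxVerts k (# 1))
                (++⁺ (unique-boxVerts k (# 2)) (unique-boxVerts k (# 3)) (disjoint-boxVerts k λ ()))
                (disjoint-++ (boxVerts k (# 2)) (disjoint-boxVerts k λ ()) (disjoint-boxVerts k λ ())))
           (disjoint-++ (boxVerts k (# 1)) (disjoint-boxVerts k λ ())
             (disjoint-++ (boxVerts k (# 2)) (disjoint-boxVerts k λ ()) (disjoint-boxVerts k λ ()))))
      cycle#boxes
  where
  cycle#boxes : Disjoint cycleVerts (boxVerts k (# 0) ++ boxVerts k (# 1) ++ boxVerts k (# 2) ++ boxVerts k (# 3))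
  cycle#boxes (x∈c , x∈b) with ∈-tabulate⁻ {f = c} x∈c | boxes-cases k x∈b
  ... | i , refl | j , x∈ⱼ = ¬Owned-c (boxVerts-owned k j x∈ⱼ)

lowBit : ℕ → Bool
lowBit zero          = false
lowBit (suc zero)    = true
lowBit (suc (suc n)) = lowBit n

binary-expansion : ∀ n → bit (lowBit n) + 2 * ⌊ n /2⌋ ≡ n
binary-expansion zero          = refl
binary-expansion (suc zero)    = refl
binary-expansion (suc (suc n)) = begin
  bit (lowBit n) + 2 * suc ⌊ n /2⌋          ≡⟨ cong (bit (lowBit n) +_) (*-suc 2 ⌊ n /2⌋) ⟩
  bit (lowBit n) + suc (suc (2 * ⌊ n /2⌋))  ≡⟨ +-suc _ _ ⟩
  suc (bit (lowBit n) + suc (2 * ⌊ n /2⌋))  ≡⟨ cong suc (+-suc _ _) ⟩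
  suc (suc (bit (lowBit n) + 2 * ⌊ n /2⌋))  ≡⟨ cong (λ m → suc (suc m)) (binary-expansion n) ⟩
  suc (suc n)                                ∎
  where open ≡-Reasoning

digit : ℕ → ℕ → Bool
digit n zero    = lowBit n
digit n (suc i) = digit ⌊ n /2⌋ i

digits-injective : ∀ k {n n′} → n < 2 ^ k → n′ < 2 ^ k → (∀ i → i < k → digit n i ≡ digit n′ i) → n ≡ n′
digits-injective zero    n<1 n′<1 _ = trans (n<1⇒n≡0 n<1) (sym (n<1⇒n≡0 n′<1))
digits-injective (suc k) {n} {n′} n< n′< same = begin
  n                               ≡⟨ sym (binary-expansion n) ⟩
  bit (lowBit n) + 2 * ⌊ n /2⌋    ≡⟨ cong₂ (λ b h → bit b + 2 * h) (same 0 (s≤s z≤n))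
                                       (digits-injective k (half< n n<) (half< n′ n′<) (λ i i<k → same (suc i) (s≤s i<k))) ⟩
  bit (lowBit n′) + 2 * ⌊ n′ /2⌋  ≡⟨ binary-expansion n′ ⟩
  n′                              ∎
  where
  open ≡-Reasoning
  half< : ∀ m → m < 2 * 2 ^ k → ⌊ m /2⌋ < 2 ^ k
  half< m m< = *-cancelˡ-< 2 _ _
    (≤-<-trans (subst (2 * ⌊ m /2⌋ ≤_) (binary-expansion m) (m≤n+m (2 * ⌊ m /2⌋) (bit (lowBit m)))) m<)

module Gadget (k′ : ℕ) where

  k : ℕ
  k = suc k′

  ends-distinct : ∀ j → proj₁ (ends j) ≢ proj₂ (ends j)
  ends-distinct fzero                      ()
  ends-distinct (fsuc fzero)               ()
  ends-distinct (fsuc (fsuc fzero))        ()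
  ends-distinct (fsuc (fsuc (fsuc fzero))) ()

  module B (j : Fin 4) = Box k′ j (proj₁ (ends j)) (proj₂ (ends j)) (ends-distinct j)

  private
    R₁ R₂ R₃ : List Edge
    R₁ = B.edges (# 1) ++ R₂
    R₂ = B.edges (# 2) ++ R₃
    R₃ = B.edges (# 3)

    from₀ : EdgeSet (Hedges k) → EdgeSet (B.edges (# 0) ++ R₁)
    from₀ M = proj₂ (split cycleEdges (B.edges (# 0) ++ R₁) M)
    from₁ : EdgeSet (Hedges k) → EdgeSet R₁
    from₁ M = proj₂ (split (B.edges (# 0)) R₁ (from₀ M))
    from₂ : EdgeSet (Hedges k) → EdgeSet R₂
    from₂ M = proj₂ (split (B.edges (# 1)) R₂ (from₁ M))

  assemble : EdgeSet cycleEdges → ((j : Fin 4) → EdgeSet (B.edges j)) → EdgeSet (Hedges k)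
  assemble C N =
    join cycleEdges (B.edges (# 0) ++ R₁) C
      (join (B.edges (# 0)) R₁ (N (# 0)) (join (B.edges (# 1)) R₂ (N (# 1)) (join (B.edges (# 2)) R₃ (N (# 2)) (N (# 3)))))

  cyclePart : EdgeSet (Hedges k) → EdgeSet cycleEdges
  cyclePart M = proj₁ (split cycleEdges (B.edges (# 0) ++ R₁) M)

  boxPart : EdgeSet (Hedges k) → (j : Fin 4) → EdgeSet (B.edges j)
  boxPart M fzero                      = proj₁ (split (B.edges (# 0)) R₁ (from₀ M))
  boxPart M (fsuc fzero)               = proj₁ (split (B.edges (# 1)) R₂ (from₁ M))
  boxPart M (fsuc (fsuc fzero))        = proj₁ (split (B.edges (# 2)) R₃ (from₂ M))
  boxPart M (fsuc (fsuc (fsuc fzero))) = proj₂ (split (B.edges (# 2)) R₃ (from₂ M))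

  assemble-parts : ∀ M → assemble (cyclePart M) (boxPart M) ≡ M
  assemble-parts M =
    trans (cong (join cycleEdges (B.edges (# 0) ++ R₁) (cyclePart M))
            (trans (cong (join (B.edges (# 0)) R₁ (boxPart M (# 0)))
                     (trans (cong (join (B.edges (# 1)) R₂ (boxPart M (# 1))) (join-split (B.edges (# 2)) R₃ (from₂ M)))
                            (join-split (B.edges (# 1)) R₂ (from₁ M))))
                   (join-split (B.edges (# 0)) R₁ (from₀ M))))
          (join-split cycleEdges (B.edges (# 0) ++ R₁) M)

  assemble-cong : ∀ C {N N′} → (∀ j → N j ≡ N′ j) → assemble C N ≡ assemble C N′
  assemble-cong C N≗N′ rewrite N≗N′ (# 0) | N≗N′ (# 1) | N≗N′ (# 2) | N≗N′ (# 3) = refl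

  cyclePart-assemble : ∀ C N → cyclePart (assemble C N) ≡ C
  cyclePart-assemble C N = cong proj₁ (split-join cycleEdges (B.edges (# 0) ++ R₁) C _)

  boxPart₀-assemble : ∀ C N → boxPart (assemble C N) (# 0) ≡ N (# 0)
  boxPart₀-assemble C N =
    trans (cong (λ M → proj₁ (split (B.edges (# 0)) R₁ (proj₂ M)))
                (split-join cycleEdges (B.edges (# 0) ++ R₁) C (join (B.edges (# 0)) R₁ (N (# 0)) _)))
          (cong proj₁ (split-join (B.edges (# 0)) R₁ (N (# 0)) _))

  deg-assemble : ∀ C N x →
    degree (Hedges k) (assemble C N) x ≡ deg cycleEdges C x + Σ₄ (λ j → deg (B.edges j) (N j) x)
  deg-assemble C N x =
    trans (degree≡deg (Hedges k) (assemble C N) x)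
          (trans (deg-join cycleEdges (B.edges (# 0) ++ R₁) C _ x)
                 (cong (deg cycleEdges C x +_)
                       (trans (deg-join (B.edges (# 0)) R₁ (N (# 0)) _ x)
                              (cong (deg (B.edges (# 0)) (N (# 0)) x +_)
                                    (trans (deg-join (B.edges (# 1)) R₂ (N (# 1)) _ x)
                                           (cong (deg (B.edges (# 1)) (N (# 1)) x +_)
                                                 (deg-join (B.edges (# 2)) R₃ (N (# 2)) (N (# 3)) x)))))))

  gadgetDeg : EdgeSet cycleEdges → (Fin 4 → Choice) → V → ℕ
  gadgetDeg C Cs x = deg cycleEdges C x + Σ₄ (λ j → B.boxDeg j (Cs j) x)

  boxChoice : EdgeSet (Hedges k) → Fin 4 → Choice
  boxChoice M j = B.choiceOf j (boxPart M j)

  degree≡gadgetDeg : ∀ M x → degree (Hedges k) M x ≡ gadgetDeg (cyclePart M) (boxChoice M) x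
  degree≡gadgetDeg M x =
    trans (cong (λ N → degree (Hedges k) N x) (sym (assemble-parts M)))
          (trans (deg-assemble (cyclePart M) (boxPart M) x)
                 (cong (deg cycleEdges (cyclePart M) x +_) (Σ₄-cong (λ j → B.deg≡boxDeg j (boxPart M j) x))))

  configuration : EdgeSet cycleEdges → (Fin 4 → Choice) → EdgeSet (Hedges k)
  configuration C Cs = assemble C (λ j → B.edgeSet j (Cs j))

  degree-configuration : ∀ C Cs x → degree (Hedges k) (configuration C Cs) x ≡ gadgetDeg C Cs x
  degree-configuration C Cs x =
    trans (deg-assemble C (λ j → B.edgeSet j (Cs j)) x)
          (cong (deg cycleEdges C x +_) (Σ₄-cong (λ j → B.deg-edgeSet j (Cs j) x)))

  idleConfiguration : EdgeSet cycleEdges → EdgeSet (Hedges k)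
  idleConfiguration C = configuration C (λ _ → idle)

  deg-cycleEdges-owned : ∀ C {j x} → Owned j x → deg cycleEdges C x ≡ 0
  deg-cycleEdges-owned (_ ∷ _ ∷ _ ∷ _ ∷ _ ∷ _ ∷ _ ∷ _ ∷ _ ∷ _ ∷ _ ∷ _ ∷ _ ∷ []) (pv-own s) = refl
  deg-cycleEdges-owned (_ ∷ _ ∷ _ ∷ _ ∷ _ ∷ _ ∷ _ ∷ _ ∷ _ ∷ _ ∷ _ ∷ _ ∷ _ ∷ []) (av-own i) = refl
  deg-cycleEdges-owned (_ ∷ _ ∷ _ ∷ _ ∷ _ ∷ _ ∷ _ ∷ _ ∷ _ ∷ _ ∷ _ ∷ _ ∷ _ ∷ []) (bv-own i) = refl

  gadgetDeg-owned : ∀ C Cs {j x} → Owned j x → gadgetDeg C Cs x ≡ B.boxDeg j (Cs j) x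
  gadgetDeg-owned C Cs {j} {x} own =
    cong₂ _+_ (deg-cycleEdges-owned C own)
              (Σ₄-single (λ j′ → B.boxDeg j′ (Cs j′) x) j
                         (λ j′ j′≢j → B.boxDeg-far j′ (Cs j′) x (B.owned-far j′ {j} {x} (j′≢j ∘ sym) own)))

  gadgetDeg-c : ∀ C Cs → (∀ j → B.Interior j (Cs j)) → ∀ i →
    gadgetDeg C Cs (c i) ≡ deg cycleEdges C (c i) + Σ₄ (λ j → atEnds (ends j) (B.boxDeg j (Cs j) (c (proj₁ (ends j)))) i)
  gadgetDeg-c C Cs interior i = cong (deg cycleEdges C (c i) +_) (Σ₄-cong (λ j → B.atEnds-boxDeg j {Cs j} (interior j) i))

  BoxesCovered : EdgeSet (Hedges k) → Set
  BoxesCovered M = ∀ j x → x ∈ boxVerts k j → degree (Hedges k) M x ≡ 1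

  record Reduction (M : EdgeSet (Hedges k)) : Set where
    field
      used          : Fin 4 → Bool
      cycle-degrees : ∀ i → degree (Hedges k) M (c i) ≡ skeletonDeg (cyclePart M) used i
      all-idle      : (∀ j → used j ≡ false) → M ≡ idleConfiguration (cyclePart M)

  reduce : ∀ M → IsMatching (Hedges k) M → BoxesCovered M → Reduction M
  reduce M matching full = record { used = d ; cycle-degrees = cycle-degrees ; all-idle = all-idle }
    where
    C  = cyclePart M
    Cs = boxChoice M

    start : Fin 4 → V
    start j = c (proj₁ (ends j))

    interior : ∀ j → B.Interior j (Cs j)
    interior j x x∈ = trans (sym (gadgetDeg-owned C Cs (boxVerts-owned k j x∈)))
                            (trans (sym (degree≡gadgetDeg M x)) (full j x x∈))

    start≤1 : ∀ j → B.boxDeg j (Cs j) (start j) ≤ 1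
    start≤1 j = ≤-trans (summand≤Σ₄ (λ j′ → B.boxDeg j′ (Cs j′) (start j)) j)
                  (≤-trans (m≤n+m _ (deg cycleEdges C (start j)))
                           (subst (_≤ 1) (degree≡gadgetDeg M (start j)) (matching (start j))))

    d : Fin 4 → Bool
    d j = proj₁ (≤1⇒bit (start≤1 j))

    start≡d : ∀ j → B.boxDeg j (Cs j) (start j) ≡ bit (d j)
    start≡d j = proj₂ (≤1⇒bit (start≤1 j))

    cycle-degrees : ∀ i → degree (Hedges k) M (c i) ≡ skeletonDeg C d i
    cycle-degrees i = trans (degree≡gadgetDeg M (c i))
      (trans (gadgetDeg-c C Cs interior i)
             (cong (deg cycleEdges C (c i) +_) (Σ₄-cong (λ j → cong (λ n → atEnds (ends j) n i) (start≡d j)))))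

    all-idle : (∀ j → d j ≡ false) → M ≡ idleConfiguration C
    all-idle unused = trans (sym (assemble-parts M)) (assemble-cong C (λ j →
      trans (sym (B.edgeSet-choiceOf j (boxPart M j)))
            (B.idle-unique j {Cs j} (interior j) (trans (start≡d j) (cong bit (unused j))))))

  perfect⇒covered : ∀ {M} → IsPerfectMatching (Hverts k) (Hedges k) M → BoxesCovered M
  perfect⇒covered (_ , covered) j x x∈ = covered x (boxVerts⊆Hverts k j x∈)

  missing⇒covered : ∀ {M p q} → InN (Hverts k) (Hedges k) (c p) (c q) M → BoxesCovered M
  missing⇒covered {M} (matching , unmatched) j x x∈ = ≤1∧≢0⇒≡1 (matching x) deg≢0
    where
    deg≢0 : degree (Hedges k) M x ≢ 0
    deg≢0 deg≡0 with Equivalence.to (unmatched x (boxVerts⊆Hverts k j x∈)) deg≡0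
    ... | inj₁ refl = ¬Owned-c (boxVerts-owned k j x∈)
    ... | inj₂ refl = ¬Owned-c (boxVerts-owned k j x∈)

  missing⇒cycle-degrees : ∀ {M p q} → InN (Hverts k) (Hedges k) (c p) (c q) M →
                          ∀ i → degree (Hedges k) M (c i) ≡ missingDeg p q i
  missing⇒cycle-degrees {M} {p} {q} (matching , unmatched) i with missingDeg-cases p q i
  ... | inj₁ (m≡0 , at)  = trans (Equivalence.from (unmatched (c i) (c∈Hverts k i)) at) (sym m≡0)
  ... | inj₂ (m≡1 , ¬at) =
    trans (≤1∧≢0⇒≡1 (matching (c i)) (¬at ∘ Equivalence.to (unmatched (c i) (c∈Hverts k i)))) (sym m≡1)

  module _ (C : EdgeSet cycleEdges) (e : Fin 4 → Bool) (g : ℕ → Bool) where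

    private
      Cs : Fin 4 → Choice
      Cs j = standard (e j) g

      M : EdgeSet (Hedges k)
      M = configuration C Cs

      interior : ∀ j → B.Interior j (Cs j)
      interior j = B.standard-interior j (e j) g

      owned-deg : ∀ {j x} → Owned j x → degree (Hedges k) M x ≡ B.boxDeg j (Cs j) x
      owned-deg own = trans (degree-configuration C Cs _) (gadgetDeg-owned C Cs own)

      owned≤1 : ∀ {j x} → Owned j x → degree (Hedges k) M x ≤ 1
      owned≤1 {j} own = subst (_≤ 1) (sym (owned-deg own)) (B.owned-≤1 j {Cs j} (interior j) own)

    standard-cycle-degrees : ∀ i → degree (Hedges k) M (c i) ≡ skeletonDeg C e i
    standard-cycle-degrees i =
      trans (degree-configuration C Cs (c i))
            (trans (gadgetDeg-c C Cs interior i)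
                   (cong (deg cycleEdges C (c i) +_)
                         (Σ₄-cong (λ j → cong (λ n → atEnds (ends j) n i) (B.standard-start j (e j) g)))))

    standard-covered : BoxesCovered M
    standard-covered j x x∈ = trans (owned-deg (boxVerts-owned k j x∈)) (interior j x x∈)

    standard-matching : (∀ i → skeletonDeg C e i ≤ 1) → IsMatching (Hedges k) M
    standard-matching ≤1 (c i)    = subst (_≤ 1) (sym (standard-cycle-degrees i)) (≤1 i)
    standard-matching ≤1 (pv j s) = owned≤1 (pv-own s)
    standard-matching ≤1 (av j i) = owned≤1 (av-own i)
    standard-matching ≤1 (bv j i) = owned≤1 (bv-own i)

    standard-perfect : (∀ i → skeletonDeg C e i ≡ 1) → IsPerfectMatching (Hverts k) (Hedges k) M
    standard-perfect deg≡1 = standard-matching (λ i → ≤-reflexive (deg≡1 i)) , covered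
      where
      covered : ∀ x → x ∈ Hverts k → degree (Hedges k) M x ≡ 1
      covered x x∈ with Hverts-cases k x∈
      ... | inj₁ (i , refl) = trans (standard-cycle-degrees i) (deg≡1 i)
      ... | inj₂ (j , x∈ⱼ)  = standard-covered j x x∈ⱼ

    standard-missing : ∀ p q → (∀ i → skeletonDeg C e i ≡ missingDeg p q i) →
                       InN (Hverts k) (Hedges k) (c p) (c q) M
    standard-missing p q deg≡ = standard-matching (λ i → subst (_≤ 1) (sym (deg≡ i)) (missingDeg≤1 i)) , unmatched
      where
      missingDeg≤1 : ∀ i → missingDeg p q i ≤ 1
      missingDeg≤1 i with missingDeg-cases p q i
      ... | inj₁ (m≡0 , _) = subst (_≤ 1) (sym m≡0) z≤n
      ... | inj₂ (m≡1 , _) = ≤-reflexive m≡1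

      unmatched : ∀ x → x ∈ Hverts k → (degree (Hedges k) M x ≡ 0 ⇔ (x ≡ c p ⊎ x ≡ c q))
      unmatched x x∈ with Hverts-cases k x∈
      ... | inj₂ (j , x∈ⱼ) = mk⇔ (λ deg≡0 → ⊥-elim (1+n≢0 (trans (sym (standard-covered j x x∈ⱼ)) deg≡0)))
                                  (λ { (inj₁ refl) → ⊥-elim (¬Owned-c (boxVerts-owned k j x∈ⱼ))
                                     ; (inj₂ refl) → ⊥-elim (¬Owned-c (boxVerts-owned k j x∈ⱼ)) })
      ... | inj₁ (i , refl) with missingDeg-cases p q i
      ...   | inj₁ (m≡0 , at)  = mk⇔ (λ _ → at) (λ _ → trans (standard-cycle-degrees i) (trans (deg≡ i) m≡0))
      ...   | inj₂ (m≡1 , ¬at) =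
        mk⇔ (λ deg≡0 → ⊥-elim (1+n≢0 (trans (sym m≡1) (trans (sym (deg≡ i)) (trans (sym (standard-cycle-degrees i)) deg≡0)))))
            (⊥-elim ∘ ¬at)

  perfect-matchings : HasCard {Hedges k} (IsPerfectMatching (Hverts k) (Hedges k)) 2
  perfect-matchings = matchings , injective , perfect , onto
    where
    matchings : Fin 2 → EdgeSet (Hedges k)
    matchings fzero        = idleConfiguration alternating₁
    matchings (fsuc fzero) = idleConfiguration alternating₂

    alternating₁≢₂ : alternating₁ ≢ alternating₂
    alternating₁≢₂ ()

    cyclePart-idle : ∀ C → cyclePart (idleConfiguration C) ≡ C
    cyclePart-idle C = cyclePart-assemble C (λ j → B.edgeSet j idle)

    injective : Injective _≡_ _≡_ matchings
    injective {fzero}      {fzero}      _  = refl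
    injective {fsuc fzero} {fsuc fzero} _  = refl
    injective {fzero}      {fsuc fzero} eq =
      ⊥-elim (alternating₁≢₂ (trans (sym (cyclePart-idle alternating₁)) (trans (cong cyclePart eq) (cyclePart-idle alternating₂))))
    injective {fsuc fzero} {fzero}      eq =
      ⊥-elim (alternating₁≢₂ (trans (sym (cyclePart-idle alternating₁)) (trans (cong cyclePart (sym eq)) (cyclePart-idle alternating₂))))

    perfect : ∀ n → IsPerfectMatching (Hverts k) (Hedges k) (matchings n)
    perfect fzero        = standard-perfect alternating₁ noBoxes (λ _ → false)
                             (from-yes (FinP.all? λ i → skeletonDeg alternating₁ noBoxes i ≟ 1))
    perfect (fsuc fzero) = standard-perfect alternating₂ noBoxes (λ _ → false)
                             (from-yes (FinP.all? λ i → skeletonDeg alternating₂ noBoxes i ≟ 1))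

    onto : ∀ M → IsPerfectMatching (Hverts k) (Hedges k) M → ∃ λ n → matchings n ≡ M
    onto M pm@(matching , covered) =
      identify (perfect-skeleton (cyclePart M) (used (# 0)) (used (# 1)) (used (# 2)) (used (# 3))
                                 (λ i → trans (sym (cycle-degrees i)) (covered (c i) (c∈Hverts k i))))
      where
      open Reduction (reduce M matching (perfect⇒covered {M} pm))
      identify : NoBoxUsed (used (# 0)) (used (# 1)) (used (# 2)) (used (# 3))
               × (cyclePart M ≡ alternating₁ ⊎ cyclePart M ≡ alternating₂) → ∃ λ n → matchings n ≡ M
      identify (unused , inj₁ C≡) = fzero      , sym (trans (all-idle (NoBoxUsed⇒ unused)) (cong idleConfiguration C≡))
      identify (unused , inj₂ C≡) = fsuc fzero , sym (trans (all-idle (NoBoxUsed⇒ unused)) (cong idleConfiguration C≡))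

  uv-matchings : HasCard {Hedges k} (InN (Hverts k) (Hedges k) u v) 1
  uv-matchings = (λ _ → idleConfiguration skeletonUV) , (λ { {fzero} {fzero} _ → refl }) , (λ _ → missing-uv) , onto
    where
    missing-uv : InN (Hverts k) (Hedges k) u v (idleConfiguration skeletonUV)
    missing-uv = standard-missing skeletonUV noBoxes (λ _ → false) (# 3) (# 9)
                   (from-yes (FinP.all? λ i → skeletonDeg skeletonUV noBoxes i ≟ missingDeg (# 3) (# 9) i))

    onto : ∀ M → InN (Hverts k) (Hedges k) u v M → ∃ λ n → idleConfiguration skeletonUV ≡ M
    onto M uv@(matching , _) =
      fzero , sym (trans (all-idle (NoBoxUsed⇒ (proj₁ skeleton))) (cong idleConfiguration (proj₂ skeleton)))
      where
      open Reduction (reduce M matching (missing⇒covered {M} uv))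
      skeleton = uv-skeleton (cyclePart M) (used (# 0)) (used (# 1)) (used (# 2)) (used (# 3))
                             (λ i → trans (sym (cycle-degrees i)) (missing⇒cycle-degrees {M} uv i))

  x₁v-matchings : HasCardAtLeast {Hedges k} (InN (Hverts k) (Hedges k) x₁ v) (2 ^ k)
  x₁v-matchings = matchings , injective , missing-x₁v
    where
    boxes : Fin (2 ^ k) → (j : Fin 4) → EdgeSet (B.edges j)
    boxes n j = B.edgeSet j (standard (firstBox j) (digit (toℕ n)))

    matchings : Fin (2 ^ k) → EdgeSet (Hedges k)
    matchings n = assemble skeletonX (boxes n)

    missing-x₁v : ∀ n → InN (Hverts k) (Hedges k) x₁ v (matchings n)
    missing-x₁v n = standard-missing skeletonX firstBox (digit (toℕ n)) (# 1) (# 9)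
                      (from-yes (FinP.all? λ i → skeletonDeg skeletonX firstBox i ≟ missingDeg (# 1) (# 9) i))

    injective : Injective _≡_ _≡_ matchings
    injective {n} {n′} eq = FinP.toℕ-injective
      (digits-injective k (FinP.toℕ<n n) (FinP.toℕ<n n′)
        (B.crossing-injective (# 0)
          (trans (sym (boxPart₀-assemble skeletonX (boxes n)))
                 (trans (cong (λ M → boxPart M (# 0)) eq) (boxPart₀-assemble skeletonX (boxes n′))))))

lemma1 : (k : ℕ) → 1 ≤ k →
    (length (Hverts k) ≡ 16 * k + 4 × Unique (Hverts k))
    × HasCard {Hedges k} (IsPerfectMatching (Hverts k) (Hedges k)) 2
    × HasCard {Hedges k} (InN (Hverts k) (Hedges k) u v) 1
    × HasCardAtLeast {Hedges k} (InN (Hverts k) (Hedges k) x₁ v) (2 ^ k)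
lemma1 (suc k′) _ = (length-Hverts k′ , unique-Hverts (suc k′)) , perfect-matchings , uv-matchings , x₁v-matchings
  where open Gadget k′
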